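{- Let $R_n$ be the $n\times n$ real matrix whose $(i,j)$ entry is $\binom{i-1}{n-j}$, and let $\phi=\frac{1+\sqrt5}{2}$, $\bar\phi=\frac{1-\sqrt5}{2}$. Then the eigenvalues of $R_n$ are: (1) if $n=2k$: $(-1)^{k+i}\phi^{2i-1}$ and $(-1)^{k+i}\bar\phi^{2i-1}$ for $i=1,\ldots,k$; (2) if $n=2k+1$: $(-1)^k$, together with $(-1)^{k+i}\phi^{2i}$ and $(-1)^{k+i}\bar\phi^{2i}$ for $i=1,\ldots,k$.
   Context: Binomial coefficients $\binom{a}{b}$ are $0$ when $b<0$ or $b>a$. -}

module Defs where

open import Data.Nat using (ℕ; zero; suc; _∸_) renaming (_+_ to _+ℕ_; _*_ to _*ℕ_)
open import Data.Nat.Combinatorics using (_C_)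
open import Data.Integer using (ℤ; +_; -[1+_]) renaming (_+_ to _+ℤ_; _*_ to _*ℤ_; -_ to -ℤ_)
open import Data.Fin using (Fin; zero; suc; toℕ; punchIn)
open import Data.List using (List; []; _∷_)
open import Relation.Binary.PropositionalEquality using (_≡_)
open import Relation.Nullary using (yes; no)
open import Data.Fin using (_≟_)

-- The ring ℤ[φ] ⊂ ℝ, φ = (1+√5)/2, element ⟨ a , b ⟩ denotes a + b·φ.
-- (φ² = φ + 1.)  It contains φ̄ = (1-√5)/2 = 1 - φ.

record Zφ : Set where
  constructor ⟨_,_⟩
  field
    re : ℤ
    im : ℤ

infixl 6 _+φ_ _-φ_
infixl 7 _*φ_

0φ 1φ φ φ̄ : Zφ
0φ = ⟨ + 0 , + 0 ⟩
1φ = ⟨ + 1 , + 0 ⟩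
φ  = ⟨ + 0 , + 1 ⟩
φ̄  = ⟨ + 1 , -[1+ 0 ] ⟩

_+φ_ : Zφ → Zφ → Zφ
⟨ a , b ⟩ +φ ⟨ c , d ⟩ = ⟨ a +ℤ c , b +ℤ d ⟩

-φ_ : Zφ → Zφ
-φ ⟨ a , b ⟩ = ⟨ -ℤ a , -ℤ b ⟩

_-φ_ : Zφ → Zφ → Zφ
x -φ y = x +φ (-φ y)

_*φ_ : Zφ → Zφ → Zφ
⟨ a , b ⟩ *φ ⟨ c , d ⟩ = ⟨ a *ℤ c +ℤ b *ℤ d , a *ℤ d +ℤ b *ℤ c +ℤ b *ℤ d ⟩

_^φ_ : Zφ → ℕ → Zφ
x ^φ zero  = 1φ
x ^φ suc m = x *φ (x ^φ m)

fromℕφ : ℕ → Zφ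
fromℕφ m = ⟨ + m , + 0 ⟩

sgn : ℕ → Zφ
sgn m = (-φ 1φ) ^φ m

-- Polynomials over ℤ[φ]: coefficient lists, lowest degree first.

Poly : Set
Poly = List Zφ

_+P_ : Poly → Poly → Poly
[]       +P q        = q
p        +P []       = p
(a ∷ p)  +P (b ∷ q)  = (a +φ b) ∷ (p +P q)

scaleP : Zφ → Poly → Poly
scaleP c []      = []
scaleP c (a ∷ p) = (c *φ a) ∷ scaleP c p

_*P_ : Poly → Poly → Poly
[]      *P q = []
(a ∷ p) *P q = scaleP a q +P (0φ ∷ (p *P q))

-P_ : Poly → Poly
-P p = scaleP (-φ 1φ) p

_-P_ : Poly → Poly → Poly
p -P q = p +P (-P q)

constP : Zφ → Poly
constP c = c ∷ []

X : Poly
X = 0φ ∷ 1φ ∷ []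

coeff : Poly → ℕ → Zφ
coeff []      _       = 0φ
coeff (a ∷ p) zero    = a
coeff (a ∷ p) (suc i) = coeff p i

infix 4 _≈P_
_≈P_ : Poly → Poly → Set
p ≈P q = ∀ i → coeff p i ≡ coeff q i

prodP : ℕ → (ℕ → Poly) → Poly
prodP zero    f = constP 1φ
prodP (suc k) f = prodP k f *P f (suc k)

Matrix : Set → ℕ → Set
Matrix A n = Fin n → Fin n → A

sumFin : ∀ {n} → (Fin n → Poly) → Poly
sumFin {zero}  f = []
sumFin {suc n} f = f zero +P sumFin (λ j → f (suc j))

minor : ∀ {n} → Matrix Poly (suc n) → Fin (suc n) → Matrix Poly n
minor M j r c = M (suc r) (punchIn j c)

det : ∀ {n} → Matrix Poly n → Poly
det {zero}  M = constP 1φ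
det {suc n} M = sumFin (λ j → scaleP (sgn (toℕ j)) (M zero j *P det (minor M j)))

charPoly : ∀ {n} → Matrix Zφ n → Poly
charPoly {n} A = det (λ i j → idX i j -P constP (A i j))
  where
  idX : Fin n → Fin n → Poly
  idX i j with i ≟ j
  ... | yes _ = X
  ... | no  _ = []

-- R_n : (i,j) entry (1-based) is binom(i-1, n-j).
-- With 0-based i', j' (i = i'+1, j = j'+1): binom(i', n - 1 - j').

R : (n : ℕ) → Matrix Zφ n
R n i j = fromℕφ (toℕ i C (n ∸ suc (toℕ j)))

pairFactor : Zφ → Zφ → Poly
pairFactor l l' = (X -P constP l) *P (X -P constP l')

-- Encode a row (v₀, …, v_{N−1}) as the polynomial Σⱼ vⱼ X^(N−1−j), so that row m of R_N becomes
-- (X + 1)^m.  Let G be the upper unitriangular matrix whose row r encodes (X + φ)^(N−1−r), and T the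
-- lower triangular matrix with entries C(r, s) φ^(N−1−r) φ̄^s.  By the binomial theorem, φ² = φ + 1
-- and φ + φ̄ = 1, row r of both G R_N and T G encodes φ^a (X + φ)^a (X + 1)^r with a = N − 1 − r, so
-- G R_N = T G.  Hence X·I − R_N and X·I − T have the same determinant ∏_b (X − φ^(N−1−b) φ̄^b), and
-- as φ φ̄ = −1 the factors for b = j and b = N − 1 − j are X − (−1)^j φ^(N−1−2j) and
-- X − (−1)^j φ̄^(N−1−2j).

{-# OPTIONS --safe #-}
module Submission where

open import Algebra.Bundles using (CommutativeRing)
open import Level using (0ℓ)
open import Data.Nat.Base as ℕ using (ℕ; zero; suc; z≤n; s≤s; _<_; _≤_; _∸_; pred)
import Data.Nat.Properties as ℕ
open import Relation.Binary.PropositionalEquality as ≡ using (_≡_; _≢_)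

module BigOperators {c ℓ} (R : CommutativeRing c ℓ) where

  open CommutativeRing R hiding (zero)
  open import Algebra.Solver.Ring.NaturalCoefficients.Default commutativeSemiring using (solve; _:=_; _:*_)
  open import Algebra.Properties.Semiring.Exp semiring using (_^_) public
  open import Algebra.Properties.Semiring.Mult semiring using (_×_)
  open import Data.Fin.Base using (toℕ)
  open import Data.Nat.Combinatorics using (_C_)
  open import Algebra.Properties.CommutativeSemigroup *-commutativeSemigroup using (x∙yz≈y∙xz)
  open import Relation.Binary.Reasoning.Setoid setoid

  ∑ : ℕ → (ℕ → Carrier) → Carrier
  ∑ zero    f = 0#
  ∑ (suc n) f = f 0 + ∑ n (λ i → f (suc i))

  ∏ : ℕ → (ℕ → Carrier) → Carrier
  ∏ zero    f = 1#
  ∏ (suc n) f = f 0 * ∏ n (λ i → f (suc i))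

  syntax ∑ n (λ i → e) = ∑[ i < n ] e
  syntax ∏ n (λ i → e) = ∏[ i < n ] e

  ∑-cong : ∀ n {f g} → (∀ i → i < n → f i ≈ g i) → ∑ n f ≈ ∑ n g
  ∑-cong zero    f≈g = refl
  ∑-cong (suc n) f≈g = +-cong (f≈g 0 (s≤s z≤n)) (∑-cong n (λ i i<n → f≈g (suc i) (s≤s i<n)))

  ∑-zero : ∀ n {f} → (∀ i → i < n → f i ≈ 0#) → ∑ n f ≈ 0#
  ∑-zero n f≈0 = trans (∑-cong n f≈0) (lemma n)
    where
    lemma : ∀ n → ∑[ i < n ] 0# ≈ 0#
    lemma zero    = refl
    lemma (suc n) = trans (+-identityˡ _) (lemma n)

  ∑-distrib-+ : ∀ n f g → ∑[ i < n ] (f i + g i) ≈ ∑ n f + ∑ n g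
  ∑-distrib-+ zero    f g = sym (+-identityˡ 0#)
  ∑-distrib-+ (suc n) f g = trans (+-congˡ (∑-distrib-+ n _ _)) (interchange (f 0) (g 0) _ _)
    where open import Algebra.Properties.CommutativeSemigroup +-commutativeSemigroup using (interchange)

  ∑-neg : ∀ n f → ∑[ i < n ] (- f i) ≈ - ∑ n f
  ∑-neg zero    f = sym -0#≈0#
    where open import Algebra.Properties.Ring ring using (-0#≈0#)
  ∑-neg (suc n) f = trans (+-congˡ (∑-neg n _)) (-‿+-comm (f 0) _)
    where open import Algebra.Properties.Ring ring using (-‿+-comm)

  *-distribˡ-∑ : ∀ n a f → a * ∑ n f ≈ ∑[ i < n ] (a * f i)
  *-distribˡ-∑ zero    a f = zeroʳ a
  *-distribˡ-∑ (suc n) a f = trans (distribˡ a _ _) (+-congˡ (*-distribˡ-∑ n a _))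

  *-distribʳ-∑ : ∀ n a f → ∑ n f * a ≈ ∑[ i < n ] (f i * a)
  *-distribʳ-∑ n a f =
    trans (*-comm _ a) (trans (*-distribˡ-∑ n a f) (∑-cong n (λ i _ → *-comm a (f i))))

  ∑-comm : ∀ m n (f : ℕ → ℕ → Carrier) → ∑[ i < m ] ∑[ j < n ] f i j ≈ ∑[ j < n ] ∑[ i < m ] f i j
  ∑-comm zero    n f = sym (∑-zero n (λ _ _ → refl))
  ∑-comm (suc m) n f = begin
    ∑[ j < n ] f 0 j + ∑[ i < m ] ∑[ j < n ] f (suc i) j   ≈⟨ +-congˡ (∑-comm m n _) ⟩
    ∑[ j < n ] f 0 j + ∑[ j < n ] ∑[ i < m ] f (suc i) j   ≈⟨ ∑-distrib-+ n _ _ ⟨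
    ∑[ j < n ] (f 0 j + ∑[ i < m ] f (suc i) j)           ∎

  ∑-single : ∀ n k {f} → k < n → (∀ i → i < n → i ≢ k → f i ≈ 0#) → ∑ n f ≈ f k
  ∑-single (suc n) zero    {f} _ f≈0 =
    trans (+-congˡ (∑-zero n (λ i i<n → f≈0 (suc i) (s≤s i<n) (λ ())))) (+-identityʳ (f 0))
  ∑-single (suc n) (suc k) {f} (s≤s k<n) f≈0 = trans
    (+-cong (f≈0 0 (s≤s z≤n) (λ ()))
            (∑-single n k k<n (λ i i<n i≢k → f≈0 (suc i) (s≤s i<n) (i≢k ∘ ≡.cong pred))))
    (+-identityˡ _)
    where open import Function.Base using (_∘_)

  ∑-pair : ∀ n k {f} → suc k < n → (∀ i → i < n → i ≢ k → i ≢ suc k → f i ≈ 0#) →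
           ∑ n f ≈ f k + f (suc k)
  ∑-pair (suc (suc n)) zero {f} _ f≈0 = +-congˡ (trans
    (+-congˡ (∑-zero n (λ i i<n → f≈0 (suc (suc i)) (s≤s (s≤s i<n)) (λ ()) (λ ()))))
    (+-identityʳ _))
  ∑-pair (suc n) (suc k) {f} (s≤s k<n) f≈0 = trans
    (+-cong (f≈0 0 (s≤s z≤n) (λ ()) (λ ()))
            (∑-pair n k k<n (λ i i<n i≢k i≢k+1 →
               f≈0 (suc i) (s≤s i<n) (i≢k ∘ ≡.cong pred) (i≢k+1 ∘ ≡.cong pred))))
    (+-identityˡ _)
    where open import Function.Base using (_∘_)

  ∑-split : ∀ m n f → ∑ (m ℕ.+ n) f ≈ ∑ m f + ∑[ t < n ] f (m ℕ.+ t)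
  ∑-split zero    n f = sym (+-identityˡ _)
  ∑-split (suc m) n f = trans (+-congˡ (∑-split m n (λ i → f (suc i)))) (sym (+-assoc _ _ _))

  ∑-truncate : ∀ {m n} f → n ≤ m → (∀ i → n ≤ i → i < m → f i ≈ 0#) → ∑ m f ≈ ∑ n f
  ∑-truncate {m} {n} f n≤m f≈0 = begin
    ∑ m f                                ≡⟨ ≡.cong (λ k → ∑ k f) (ℕ.m+[n∸m]≡n n≤m) ⟨
    ∑ (n ℕ.+ (m ∸ n)) f                  ≈⟨ ∑-split n (m ∸ n) f ⟩
    ∑ n f + ∑[ t < m ∸ n ] f (n ℕ.+ t)   ≈⟨ +-congˡ (∑-zero (m ∸ n) tail≈0) ⟩
    ∑ n f + 0#                           ≈⟨ +-identityʳ _ ⟩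
    ∑ n f                                ∎
    where
    tail≈0 : ∀ t → t < m ∸ n → f (n ℕ.+ t) ≈ 0#
    tail≈0 t t<m∸n = f≈0 (n ℕ.+ t) (ℕ.m≤m+n n t)
      (≡.subst (n ℕ.+ t <_) (ℕ.m+[n∸m]≡n n≤m) (ℕ.+-monoʳ-< n t<m∸n))

  ∑-last : ∀ n f → ∑ (suc n) f ≈ ∑ n f + f n
  ∑-last zero    f = +-comm _ _
  ∑-last (suc n) f = trans (+-congˡ (∑-last n (λ i → f (suc i)))) (sym (+-assoc _ _ _))

  ∑-reverse : ∀ n f → ∑[ j < n ] f (n ∸ suc j) ≈ ∑ n f
  ∑-reverse zero    f = refl
  ∑-reverse (suc n) f = trans (+-congˡ (∑-reverse n f)) (trans (+-comm _ _) (sym (∑-last n f)))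

  ∏-cong : ∀ n {f g} → (∀ i → i < n → f i ≈ g i) → ∏ n f ≈ ∏ n g
  ∏-cong zero    f≈g = refl
  ∏-cong (suc n) f≈g = *-cong (f≈g 0 (s≤s z≤n)) (∏-cong n (λ i i<n → f≈g (suc i) (s≤s i<n)))

  ∏-last : ∀ n f → ∏ (suc n) f ≈ ∏ n f * f n
  ∏-last zero    f = *-comm _ _
  ∏-last (suc n) f = trans (*-congˡ (∏-last n (λ i → f (suc i)))) (sym (*-assoc _ _ _))

  ∏₁ : ℕ → (ℕ → Carrier) → Carrier
  ∏₁ zero    g = 1#
  ∏₁ (suc k) g = ∏₁ k g * g (suc k)

  ∏₁-cong : ∀ k {g h} → (∀ i → 1 ≤ i → i ≤ k → g i ≈ h i) → ∏₁ k g ≈ ∏₁ k h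
  ∏₁-cong zero    g≈h = refl
  ∏₁-cong (suc k) g≈h = *-cong (∏₁-cong k (λ i 1≤i i≤k → g≈h i 1≤i (ℕ.m≤n⇒m≤1+n i≤k)))
                               (g≈h (suc k) (s≤s z≤n) ℕ.≤-refl)

  ∏-pairs-even : ∀ k f → ∏ (k ℕ.+ k) f ≈ ∏₁ k (λ i → f (k ∸ i) * f (k ℕ.+ i ∸ 1))
  ∏-pairs-even zero    f = refl
  ∏-pairs-even (suc k) f = begin
    f 0 * ∏ (k ℕ.+ suc k) f′                              ≡⟨ ≡.cong (λ n → f 0 * ∏ n f′) (ℕ.+-suc k k) ⟩
    f 0 * (f′ 0 * ∏ (k ℕ.+ k) (λ i → f′ (suc i)))          ≈⟨ *-congˡ (∏-last (k ℕ.+ k) f′) ⟩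
    f 0 * (∏ (k ℕ.+ k) f′ * f′ (k ℕ.+ k))                  ≈⟨ *-congˡ (*-congʳ (∏-pairs-even k f′)) ⟩
    f 0 * (∏₁ k (λ i → f′ (k ∸ i) * f′ (k ℕ.+ i ∸ 1)) * f′ (k ℕ.+ k))
      ≈⟨ x∙yz≈y∙xz _ _ _ ⟩
    ∏₁ k (λ i → f′ (k ∸ i) * f′ (k ℕ.+ i ∸ 1)) * (f 0 * f′ (k ℕ.+ k))
      ≈⟨ *-cong (∏₁-cong k reindex) (*-cong (reflexive (≡.cong f (≡.sym (ℕ.n∸n≡0 k))))
                                             (reflexive (≡.cong f (≡.sym (ℕ.+-suc k k))))) ⟩
    ∏₁ (suc k) (λ i → f (suc k ∸ i) * f (suc k ℕ.+ i ∸ 1)) ∎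
    where
    f′ : ℕ → Carrier
    f′ i = f (suc i)
    reindex : ∀ i → 1 ≤ i → i ≤ k →
              f′ (k ∸ i) * f′ (k ℕ.+ i ∸ 1) ≈ f (suc k ∸ i) * f (suc k ℕ.+ i ∸ 1)
    reindex (suc i) _ i<k = *-cong (reflexive (≡.cong f (≡.sym (ℕ.+-∸-assoc 1 i<k))))
                                   (reflexive (≡.cong f (≡.trans (≡.cong (λ n → suc (n ∸ 1)) (ℕ.+-suc k i))
                                                                 (≡.sym (ℕ.+-suc k i)))))

  ∏-pairs-odd : ∀ k f → ∏ (suc (k ℕ.+ k)) f ≈ f k * ∏₁ k (λ i → f (k ∸ i) * f (k ℕ.+ i))
  ∏-pairs-odd zero    f = refl
  ∏-pairs-odd (suc k) f = begin
    f 0 * ∏ (suc (k ℕ.+ suc k)) f′                       ≡⟨ ≡.cong (λ n → f 0 * ∏ (suc n) f′) (ℕ.+-suc k k) ⟩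
    f 0 * ∏ (suc (suc (k ℕ.+ k))) f′                     ≈⟨ *-congˡ (∏-last (suc (k ℕ.+ k)) f′) ⟩
    f 0 * (∏ (suc (k ℕ.+ k)) f′ * f′ (suc (k ℕ.+ k)))     ≈⟨ *-congˡ (*-congʳ (∏-pairs-odd k f′)) ⟩
    f 0 * ((f′ k * ∏₁ k (λ i → f′ (k ∸ i) * f′ (k ℕ.+ i))) * f′ (suc (k ℕ.+ k)))
      ≈⟨ rearrange _ _ _ _ ⟩
    f′ k * (∏₁ k (λ i → f′ (k ∸ i) * f′ (k ℕ.+ i)) * (f 0 * f′ (suc (k ℕ.+ k))))
      ≈⟨ *-congˡ (*-cong (∏₁-cong k reindex) (*-cong (reflexive (≡.cong f (≡.sym (ℕ.n∸n≡0 k))))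
                                                      (reflexive (≡.cong (f ∘ suc) (≡.sym (ℕ.+-suc k k)))))) ⟩
    f′ k * ∏₁ (suc k) (λ i → f (suc k ∸ i) * f (suc k ℕ.+ i)) ∎
    where
    open import Function.Base using (_∘_)
    f′ : ℕ → Carrier
    f′ i = f (suc i)
    rearrange : ∀ a m p b → a * ((m * p) * b) ≈ m * (p * (a * b))
    rearrange = solve 4 (λ a m p b → a :* ((m :* p) :* b) := m :* (p :* (a :* b))) refl
    reindex : ∀ i → 1 ≤ i → i ≤ k → f′ (k ∸ i) * f′ (k ℕ.+ i) ≈ f (suc k ∸ i) * f (suc k ℕ.+ i)
    reindex i _ i≤k = *-congʳ (reflexive (≡.cong f (≡.sym (ℕ.+-∸-assoc 1 i≤k))))

  binomial-theorem : ∀ k x y → (x + y) ^ k ≈ ∑[ t < suc k ] ((k C t) × (x ^ t * y ^ (k ∸ t)))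
  binomial-theorem k x y =
    trans (Binomial.theorem k x y) (sum≈∑ (suc k) (λ t → (k C t) × (x ^ t * y ^ (k ∸ t))))
    where
    import Algebra.Properties.CommutativeSemiring.Binomial commutativeSemiring as Binomial
    open import Algebra.Definitions.RawMonoid +-rawMonoid using (sum)
    sum≈∑ : ∀ n (f : ℕ → Carrier) → sum {n} (λ i → f (toℕ i)) ≈ ∑ n f
    sum≈∑ zero    f = refl
    sum≈∑ (suc n) f = +-congˡ (sum≈∑ n (λ i → f (suc i)))

  1#^n≈1# : ∀ n → 1# ^ n ≈ 1#
  1#^n≈1# zero    = refl
  1#^n≈1# (suc n) = trans (*-identityˡ _) (1#^n≈1# n)

  ∑-binomial : ∀ {N n} K x y f → n < N →
               (∀ s → n < s → s < N → f s ≈ 0#) →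
               (∀ s → s ≤ n → f s ≈ K * ((n C s) × (x ^ s * y ^ (n ∸ s)))) →
               ∑ N f ≈ K * (x + y) ^ n
  ∑-binomial {N} {n} K x y f n<N vanish term = begin
    ∑ N f                                                   ≈⟨ ∑-truncate f n<N vanish ⟩
    ∑ (suc n) f                                             ≈⟨ ∑-cong (suc n) (λ s s≤n → term s (ℕ.≤-pred s≤n)) ⟩
    ∑[ s < suc n ] (K * ((n C s) × (x ^ s * y ^ (n ∸ s))))
      ≈⟨ *-distribˡ-∑ (suc n) K (λ s → (n C s) × (x ^ s * y ^ (n ∸ s))) ⟨
    K * ∑[ s < suc n ] ((n C s) × (x ^ s * y ^ (n ∸ s)))    ≈⟨ *-congˡ (binomial-theorem n x y) ⟨
    K * (x + y) ^ n                                         ∎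

module Determinant {c ℓ} (R : CommutativeRing c ℓ) where

  open CommutativeRing R hiding (zero)
  open import Algebra.Properties.Ring ring using (-‿involutive; -0#≈0#; -‿distribˡ-*; -‿distribʳ-*)
  open import Algebra.Solver.Ring.NaturalCoefficients.Default commutativeSemiring using (solve; _:=_; _:+_; _:*_)
  open BigOperators R
  open import Data.Empty using (⊥-elim)
  open import Function.Base using (_∘_)
  open import Relation.Nullary.Decidable using (yes; no)
  open import Relation.Binary.Definitions using (tri<; tri≈; tri>)
  open import Relation.Binary.Reasoning.Setoid setoid

  -- Matrices of every size share one type; the size n is passed to each operation, and only the
  -- entries with both indices below n are ever inspected.
  Matrix : Set c
  Matrix = ℕ → ℕ → Carrier

  infix 4 _≈[_]_ _≈[_∖_]_

  _≈[_]_ : Matrix → ℕ → Matrix → Set ℓ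
  M ≈[ n ] N = ∀ r c → r < n → c < n → M r c ≈ N r c

  _≈[_∖_]_ : Matrix → ℕ → ℕ → Matrix → Set ℓ
  M ≈[ n ∖ k ] N = ∀ r c → r < n → c < n → c ≢ k → M r c ≈ N r c

  sign : ℕ → Carrier
  sign zero    = 1#
  sign (suc j) = - sign j

  punchIn : ℕ → ℕ → ℕ
  punchIn zero    c       = suc c
  punchIn (suc j) zero    = zero
  punchIn (suc j) (suc c) = suc (punchIn j c)

  minor : Matrix → ℕ → Matrix
  minor M j r c = M (suc r) (punchIn j c)

  det : ℕ → Matrix → Carrier
  det zero    M = 1#
  det (suc n) M = ∑[ j < suc n ] (sign j * (M 0 j * det n (minor M j)))

  punchIn-< : ∀ {j c} → c < j → punchIn j c ≡ c
  punchIn-< {suc j} {zero}  _         = ≡.refl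
  punchIn-< {suc j} {suc c} (s≤s c<j) = ≡.cong suc (punchIn-< c<j)

  punchIn-≥ : ∀ {j c} → j ≤ c → punchIn j c ≡ suc c
  punchIn-≥ {zero}              _         = ≡.refl
  punchIn-≥ {suc j} {suc c} (s≤s j≤c) = ≡.cong suc (punchIn-≥ j≤c)

  punchInᵢ≢i : ∀ j c → punchIn j c ≢ j
  punchInᵢ≢i zero    c       ()
  punchInᵢ≢i (suc j) zero    ()
  punchInᵢ≢i (suc j) (suc c) eq = punchInᵢ≢i j c (≡.cong pred eq)

  punchIn-injective : ∀ j c c′ → punchIn j c ≡ punchIn j c′ → c ≡ c′
  punchIn-injective zero    c       c′       eq = ≡.cong pred eq
  punchIn-injective (suc j) zero    zero     eq = ≡.refl
  punchIn-injective (suc j) (suc c) (suc c′) eq = ≡.cong suc (punchIn-injective j c c′ (≡.cong pred eq))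

  punchIn-<suc : ∀ {n} j c → c < n → punchIn j c < suc n
  punchIn-<suc j c c<n = s≤s (ℕ.≤-trans (punchIn≤suc j c) c<n)
    where
    punchIn≤suc : ∀ j c → punchIn j c ≤ suc c
    punchIn≤suc zero    c       = ℕ.≤-refl
    punchIn≤suc (suc j) zero    = z≤n
    punchIn≤suc (suc j) (suc c) = s≤s (punchIn≤suc j c)

  punchOut : ℕ → ℕ → ℕ
  punchOut zero    k       = pred k
  punchOut (suc j) zero    = zero
  punchOut (suc j) (suc k) = suc (punchOut j k)

  punchIn-punchOut : ∀ j k → k ≢ j → punchIn j (punchOut j k) ≡ k
  punchIn-punchOut zero    zero    k≢j = ⊥-elim (k≢j ≡.refl)
  punchIn-punchOut zero    (suc k) k≢j = ≡.refl
  punchIn-punchOut (suc j) zero    k≢j = ≡.refl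
  punchIn-punchOut (suc j) (suc k) k≢j = ≡.cong suc (punchIn-punchOut j k (k≢j ∘ ≡.cong suc))

  punchOut-< : ∀ {n} j k → j < suc n → k < suc n → k ≢ j → punchOut j k < n
  punchOut-<         zero    zero    _         _         k≢j = ⊥-elim (k≢j ≡.refl)
  punchOut-<         zero    (suc k) _         (s≤s k<n) _   = k<n
  punchOut-< {zero}  (suc j) _       (s≤s ()) _         _
  punchOut-< {suc n} (suc j) zero    _         _         _   = s≤s z≤n
  punchOut-< {suc n} (suc j) (suc k) (s≤s j<) (s≤s k<)  k≢j = s≤s (punchOut-< j k j< k< (k≢j ∘ ≡.cong suc))

  punchOut-suc : ∀ j k → j ≢ k → j ≢ suc k → punchOut j (suc k) ≡ suc (punchOut j k)
  punchOut-suc zero          zero    j≢k _     = ⊥-elim (j≢k ≡.refl)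
  punchOut-suc zero          (suc k) _   _     = ≡.refl
  punchOut-suc (suc zero)    zero    _   j≢k+1 = ⊥-elim (j≢k+1 ≡.refl)
  punchOut-suc (suc (suc j)) zero    _   _     = ≡.refl
  punchOut-suc (suc j)       (suc k) j≢k j≢k+1 =
    ≡.cong suc (punchOut-suc j k (j≢k ∘ ≡.cong suc) (j≢k+1 ∘ ≡.cong suc))

  suc-punchOut-< : ∀ {n} j k → j < suc n → suc k < suc n → j ≢ k → j ≢ suc k → suc (punchOut j k) < n
  suc-punchOut-< j k j<n k+1<n j≢k j≢k+1 =
    ≡.subst (_< _) (punchOut-suc j k j≢k j≢k+1) (punchOut-< j (suc k) j<n k+1<n (j≢k+1 ∘ ≡.sym))

  punchIn-suc-punchOut : ∀ j k → j ≢ k → j ≢ suc k → punchIn j (suc (punchOut j k)) ≡ suc k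
  punchIn-suc-punchOut j k j≢k j≢k+1 = ≡.trans (≡.cong (punchIn j) (≡.sym (punchOut-suc j k j≢k j≢k+1)))
                                                (punchIn-punchOut j (suc k) (j≢k+1 ∘ ≡.sym))

  minor-cong : ∀ {n M N} j → j < suc n → M ≈[ suc n ] N → minor M j ≈[ n ] minor N j
  minor-cong j _ M≈N r c r<n c<n = M≈N (suc r) (punchIn j c) (s≤s r<n) (punchIn-<suc j c c<n)

  minor-agree : ∀ {n M N} k → M ≈[ suc n ∖ k ] N → minor M k ≈[ n ] minor N k
  minor-agree k M≈N r c r<n c<n = M≈N (suc r) (punchIn k c) (s≤s r<n) (punchIn-<suc k c c<n) (punchInᵢ≢i k c)

  minor-agree-off : ∀ {n M N} j k → j ≢ k → M ≈[ suc n ∖ k ] N → minor M j ≈[ n ∖ punchOut j k ] minor N j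
  minor-agree-off j k j≢k M≈N r c r<n c<n c≢k′ = M≈N (suc r) (punchIn j c) (s≤s r<n) (punchIn-<suc j c c<n)
    (λ eq → c≢k′ (punchIn-injective j c (punchOut j k)
                    (≡.trans eq (≡.sym (punchIn-punchOut j k (j≢k ∘ ≡.sym))))))

  det-cong : ∀ n {M N} → M ≈[ n ] N → det n M ≈ det n N
  det-cong zero    M≈N = refl
  det-cong (suc n) M≈N = ∑-cong (suc n) (λ j j<n →
    *-congˡ {x = sign j} (*-cong (M≈N 0 j (s≤s z≤n) j<n) (det-cong n (minor-cong j j<n M≈N))))

  private
    distrib-entry : ∀ a b s m₁ m₂ D → s * ((a * m₁ + b * m₂) * D) ≈ a * (s * (m₁ * D)) + b * (s * (m₂ * D))
    distrib-entry = solve 6 (λ a b s m₁ m₂ D →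
      s :* ((a :* m₁ :+ b :* m₂) :* D) := a :* (s :* (m₁ :* D)) :+ b :* (s :* (m₂ :* D))) refl

    distrib-minor : ∀ a b s m D₁ D₂ → s * (m * (a * D₁ + b * D₂)) ≈ a * (s * (m * D₁)) + b * (s * (m * D₂))
    distrib-minor = solve 6 (λ a b s m D₁ D₂ →
      s :* (m :* (a :* D₁ :+ b :* D₂)) := a :* (s :* (m :* D₁)) :+ b :* (s :* (m :* D₂))) refl

    s*x≈-[-s*x] : ∀ s x → s * x ≈ - (- s * x)
    s*x≈-[-s*x] s x = trans (sym (-‿involutive (s * x))) (-‿cong (-‿distribˡ-* s x))

    s*[m*-d]≈-[s*[m*d]] : ∀ s m d → s * (m * - d) ≈ - (s * (m * d))
    s*[m*-d]≈-[s*[m*d]] s m d = trans (*-congˡ (sym (-‿distribʳ-* m d))) (sym (-‿distribʳ-* s (m * d)))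

  det-linear-column : ∀ n k {M M₁ M₂} a b → k < n → M ≈[ n ∖ k ] M₁ → M ≈[ n ∖ k ] M₂ →
                      (∀ r → r < n → M r k ≈ a * M₁ r k + b * M₂ r k) →
                      det n M ≈ a * det n M₁ + b * det n M₂
  det-linear-column (suc n) k {M} {M₁} {M₂} a b k<n M≈M₁ M≈M₂ column-k = begin
    det (suc n) M                                               ≈⟨ ∑-cong (suc n) term ⟩
    ∑[ j < suc n ] (a * t M₁ j + b * t M₂ j)
      ≈⟨ ∑-distrib-+ (suc n) (λ j → a * t M₁ j) (λ j → b * t M₂ j) ⟩
    ∑[ j < suc n ] (a * t M₁ j) + ∑[ j < suc n ] (b * t M₂ j)
      ≈⟨ +-cong (*-distribˡ-∑ (suc n) a (t M₁)) (*-distribˡ-∑ (suc n) b (t M₂)) ⟨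
    a * det (suc n) M₁ + b * det (suc n) M₂                     ∎
    where
    t : Matrix → ℕ → Carrier
    t N j = sign j * (N 0 j * det n (minor N j))

    term : ∀ j → j < suc n → t M j ≈ a * t M₁ j + b * t M₂ j
    term j j<n with j ℕ.≟ k
    ... | yes ≡.refl = begin
      sign j * (M 0 j * det n (minor M j))
        ≈⟨ *-congˡ {x = sign j} (*-congʳ (column-k 0 (s≤s z≤n))) ⟩
      sign j * ((a * M₁ 0 j + b * M₂ 0 j) * det n (minor M j))
        ≈⟨ distrib-entry a b _ _ _ _ ⟩
      a * (sign j * (M₁ 0 j * det n (minor M j))) + b * (sign j * (M₂ 0 j * det n (minor M j)))
        ≈⟨ +-cong (*-congˡ {x = a} (*-congˡ {x = sign j} (*-congˡ (det-cong n (minor-agree k M≈M₁)))))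
                  (*-congˡ {x = b} (*-congˡ {x = sign j} (*-congˡ (det-cong n (minor-agree k M≈M₂))))) ⟩
      a * t M₁ j + b * t M₂ j ∎
    ... | no j≢k = begin
      sign j * (M 0 j * det n (minor M j))
        ≈⟨ *-congˡ {x = sign j} (*-congˡ (det-linear-column n (punchOut j k) a b
             (punchOut-< j k j<n k<n (j≢k ∘ ≡.sym))
             (minor-agree-off j k j≢k M≈M₁) (minor-agree-off j k j≢k M≈M₂) column-k′)) ⟩
      sign j * (M 0 j * (a * det n (minor M₁ j) + b * det n (minor M₂ j)))
        ≈⟨ distrib-minor a b _ _ _ _ ⟩
      a * (sign j * (M 0 j * det n (minor M₁ j))) + b * (sign j * (M 0 j * det n (minor M₂ j)))
        ≈⟨ +-cong (*-congˡ {x = a} (*-congˡ {x = sign j} (*-congʳ (M≈M₁ 0 j (s≤s z≤n) j<n j≢k))))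
                  (*-congˡ {x = b} (*-congˡ {x = sign j} (*-congʳ (M≈M₂ 0 j (s≤s z≤n) j<n j≢k)))) ⟩
      a * t M₁ j + b * t M₂ j ∎
      where
      column-k′ : ∀ r → r < n →
                  minor M j r (punchOut j k) ≈ a * minor M₁ j r (punchOut j k) + b * minor M₂ j r (punchOut j k)
      column-k′ r r<n = ≡.subst (λ z → M (suc r) z ≈ a * M₁ (suc r) z + b * M₂ (suc r) z)
                                (≡.sym (punchIn-punchOut j k (j≢k ∘ ≡.sym))) (column-k (suc r) (s≤s r<n))

  det-zero-column : ∀ n k {M} → k < n → (∀ r → r < n → M r k ≈ 0#) → det n M ≈ 0#
  det-zero-column n k {M} k<n column-k≈0 = begin
    det n M                         ≈⟨ det-linear-column n k 0# 0# k<n agree agree column-k ⟩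
    0# * det n M + 0# * det n M     ≈⟨ 0*x+0*y≈0 _ _ ⟩
    0#                              ∎
    where
    agree : M ≈[ n ∖ k ] M
    agree _ _ _ _ _ = refl
    0*x+0*y≈0 : ∀ x y → 0# * x + 0# * y ≈ 0#
    0*x+0*y≈0 x y = trans (+-cong (zeroˡ x) (zeroˡ y)) (+-identityˡ 0#)
    column-k : ∀ r → r < n → M r k ≈ 0# * M r k + 0# * M r k
    column-k r r<n = trans (column-k≈0 r r<n) (sym (0*x+0*y≈0 _ _))

  LowerTriangular : ℕ → Matrix → Set ℓ
  LowerTriangular n M = ∀ r c → r < c → c < n → M r c ≈ 0#

  det-lowerTriangular : ∀ n {M} → LowerTriangular n M → det n M ≈ ∏[ i < n ] M i i
  det-lowerTriangular zero    _     = refl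
  det-lowerTriangular (suc n) {M} lower = begin
    sign 0 * (M 0 0 * det n (minor M 0)) + ∑[ j < n ] t (suc j)
      ≈⟨ +-cong (*-identityˡ _) (∑-zero n (λ j j<n → first-row-zero (s≤s j<n))) ⟩
    M 0 0 * det n (minor M 0) + 0#                   ≈⟨ +-identityʳ _ ⟩
    M 0 0 * det n (minor M 0)
      ≈⟨ *-congˡ (det-lowerTriangular n (λ r c r<c c<n → lower (suc r) (suc c) (s≤s r<c) (s≤s c<n))) ⟩
    M 0 0 * ∏[ i < n ] M (suc i) (suc i)             ∎
    where
    t : ℕ → Carrier
    t j = sign j * (M 0 j * det n (minor M j))
    first-row-zero : ∀ {j} → suc j < suc n → t (suc j) ≈ 0#
    first-row-zero {j} j<n =
      trans (*-congˡ {x = sign (suc j)} (trans (*-congʳ (lower 0 (suc j) (s≤s z≤n) j<n)) (zeroˡ _))) (zeroʳ _)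

  swap : ℕ → ℕ → ℕ
  swap zero    zero          = 1
  swap zero    (suc zero)    = 0
  swap zero    (suc (suc c)) = suc (suc c)
  swap (suc k) zero          = zero
  swap (suc k) (suc c)       = suc (swap k c)

  swap-k : ∀ k → swap k k ≡ suc k
  swap-k zero    = ≡.refl
  swap-k (suc k) = ≡.cong suc (swap-k k)

  swap-suc-k : ∀ k → swap k (suc k) ≡ k
  swap-suc-k zero    = ≡.refl
  swap-suc-k (suc k) = ≡.cong suc (swap-suc-k k)

  swap-other : ∀ k j → j ≢ k → j ≢ suc k → swap k j ≡ j
  swap-other zero    zero          j≢k _     = ⊥-elim (j≢k ≡.refl)
  swap-other zero    (suc zero)    _   j≢k+1 = ⊥-elim (j≢k+1 ≡.refl)
  swap-other zero    (suc (suc j)) _   _     = ≡.refl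
  swap-other (suc k) zero          _   _     = ≡.refl
  swap-other (suc k) (suc j)       j≢k j≢k+1 =
    ≡.cong suc (swap-other k j (j≢k ∘ ≡.cong suc) (j≢k+1 ∘ ≡.cong suc))

  swap-punchIn : ∀ j k c → j ≢ k → j ≢ suc k → swap k (punchIn j c) ≡ punchIn j (swap (punchOut j k) c)
  swap-punchIn zero          zero    c             j≢k _     = ⊥-elim (j≢k ≡.refl)
  swap-punchIn zero          (suc k) c             _   _     = ≡.refl
  swap-punchIn (suc zero)    zero    c             _   j≢k+1 = ⊥-elim (j≢k+1 ≡.refl)
  swap-punchIn (suc (suc j)) zero    zero          _   _     = ≡.refl
  swap-punchIn (suc (suc j)) zero    (suc zero)    _   _     = ≡.refl
  swap-punchIn (suc (suc j)) zero    (suc (suc c)) _   _     = ≡.refl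
  swap-punchIn (suc j)       (suc k) zero          _   _     = ≡.refl
  swap-punchIn (suc j)       (suc k) (suc c)       j≢k j≢k+1 =
    ≡.cong suc (swap-punchIn j k c (j≢k ∘ ≡.cong suc) (j≢k+1 ∘ ≡.cong suc))

  swap-punchIn-k : ∀ k c → swap k (punchIn k c) ≡ punchIn (suc k) c
  swap-punchIn-k zero    zero    = ≡.refl
  swap-punchIn-k zero    (suc c) = ≡.refl
  swap-punchIn-k (suc k) zero    = ≡.refl
  swap-punchIn-k (suc k) (suc c) = ≡.cong suc (swap-punchIn-k k c)

  swap-punchIn-suc-k : ∀ k c → swap k (punchIn (suc k) c) ≡ punchIn k c
  swap-punchIn-suc-k zero    zero    = ≡.refl
  swap-punchIn-suc-k zero    (suc c) = ≡.refl
  swap-punchIn-suc-k (suc k) zero    = ≡.refl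
  swap-punchIn-suc-k (suc k) (suc c) = ≡.cong suc (swap-punchIn-suc-k k c)

  ∑-swap : ∀ n k f → suc k < n → ∑[ j < n ] f (swap k j) ≈ ∑ n f
  ∑-swap (suc (suc n)) zero    f _         = x∙yz≈y∙xz (f 1) (f 0) _
    where open import Algebra.Properties.CommutativeSemigroup +-commutativeSemigroup using (x∙yz≈y∙xz)
  ∑-swap (suc n)       (suc k) f (s≤s k<n) = +-congˡ (∑-swap n k (f ∘ suc) k<n)

  swapColumns : ℕ → Matrix → Matrix
  swapColumns k M r c = M r (swap k c)

  -- In the first-row expansion, the terms for columns k and k + 1 trade places with a sign change,
  -- and every other term has columns swapped inside its minor.
  det-swapColumns : ∀ n k M → suc k < n → det n (swapColumns k M) ≈ - det n M
  det-swapColumns (suc n) k M k+1<n = begin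
    ∑[ j < suc n ] t′ j                 ≈⟨ ∑-cong (suc n) term ⟩
    ∑[ j < suc n ] (- t (swap k j))     ≈⟨ ∑-neg (suc n) (t ∘ swap k) ⟩
    - ∑[ j < suc n ] t (swap k j)       ≈⟨ -‿cong (∑-swap (suc n) k t k+1<n) ⟩
    - ∑[ j < suc n ] t j                ∎
    where
    M′ = swapColumns k M
    t t′ : ℕ → Carrier
    t  j = sign j * (M 0 j * det n (minor M j))
    t′ j = sign j * (M′ 0 j * det n (minor M′ j))

    term : ∀ j → j < suc n → t′ j ≈ - t (swap k j)
    term j j<n with j ℕ.≟ k | j ℕ.≟ suc k
    ... | yes ≡.refl | _ = begin
      sign k * (M 0 (swap k k) * det n (minor M′ k))
        ≈⟨ *-congˡ {x = sign k} (*-cong (reflexive (≡.cong (M 0) (swap-k k)))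
             (det-cong n (λ r c _ _ → reflexive (≡.cong (M (suc r)) (swap-punchIn-k k c))))) ⟩
      sign k * (M 0 (suc k) * det n (minor M (suc k)))   ≈⟨ s*x≈-[-s*x] _ _ ⟩
      - t (suc k)                                       ≡⟨ ≡.cong (-_ ∘ t) (swap-k k) ⟨
      - t (swap k k)                                    ∎
    ... | no _ | yes ≡.refl = begin
      sign (suc k) * (M 0 (swap k (suc k)) * det n (minor M′ (suc k)))
        ≈⟨ *-congˡ {x = sign (suc k)} (*-cong (reflexive (≡.cong (M 0) (swap-suc-k k)))
             (det-cong n (λ r c _ _ → reflexive (≡.cong (M (suc r)) (swap-punchIn-suc-k k c))))) ⟩
      - sign k * (M 0 k * det n (minor M k))   ≈⟨ -‿distribˡ-* _ _ ⟨
      - t k                                    ≡⟨ ≡.cong (-_ ∘ t) (swap-suc-k k) ⟨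
      - t (swap k (suc k))                     ∎
    ... | no j≢k | no j≢k+1 rewrite swap-other k j j≢k j≢k+1 = begin
      sign j * (M 0 j * det n (minor M′ j))
        ≈⟨ *-congˡ {x = sign j} (*-congˡ (det-cong n (λ r c _ _ →
             reflexive (≡.cong (M (suc r)) (swap-punchIn j k c j≢k j≢k+1))))) ⟩
      sign j * (M 0 j * det n (swapColumns (punchOut j k) (minor M j)))
        ≈⟨ *-congˡ {x = sign j} (*-congˡ (det-swapColumns n (punchOut j k) (minor M j)
             (suc-punchOut-< j k j<n k+1<n j≢k j≢k+1))) ⟩
      sign j * (M 0 j * - det n (minor M j))   ≈⟨ s*[m*-d]≈-[s*[m*d]] _ _ _ ⟩
      - t j                                    ∎

  minor-adjacent : ∀ {n M} k → (∀ r → r < suc n → M r k ≈ M r (suc k)) → minor M (suc k) ≈[ n ] minor M k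
  minor-adjacent {n} {M} k same r c r<n _ with ℕ.<-cmp c k
  ... | tri< c<k _ _    =
    reflexive (≡.cong (M (suc r)) (≡.trans (punchIn-< (ℕ.m<n⇒m<1+n c<k)) (≡.sym (punchIn-< c<k))))
  ... | tri≈ _ ≡.refl _ = begin
    M (suc r) (punchIn (suc c) c)    ≡⟨ ≡.cong (M (suc r)) (punchIn-< (ℕ.n<1+n c)) ⟩
    M (suc r) c                      ≈⟨ same (suc r) (s≤s r<n) ⟩
    M (suc r) (suc c)                ≡⟨ ≡.cong (M (suc r)) (punchIn-≥ ℕ.≤-refl) ⟨
    M (suc r) (punchIn c c)          ∎
  ... | tri> _ _ k<c    =
    reflexive (≡.cong (M (suc r)) (≡.trans (punchIn-≥ k<c) (≡.sym (punchIn-≥ (ℕ.<⇒≤ k<c)))))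

  det-equal-adjacent-columns : ∀ n k M → suc k < n → (∀ r → r < n → M r k ≈ M r (suc k)) → det n M ≈ 0#
  det-equal-adjacent-columns (suc n) k M k+1<n same = begin
    det (suc n) M                                     ≈⟨ ∑-pair (suc n) k k+1<n away ⟩
    t k + - sign k * (M 0 (suc k) * det n (minor M (suc k)))
      ≈⟨ +-congˡ (*-congˡ {x = - sign k}
           (*-cong (sym (same 0 (s≤s z≤n))) (det-cong n (minor-adjacent {M = M} k same)))) ⟩
    t k + - sign k * (M 0 k * det n (minor M k))      ≈⟨ +-congˡ (-‿distribˡ-* _ _) ⟨
    t k + - t k                                       ≈⟨ -‿inverseʳ _ ⟩
    0#                                                ∎
    where
    t : ℕ → Carrier
    t j = sign j * (M 0 j * det n (minor M j))
    away : ∀ j → j < suc n → j ≢ k → j ≢ suc k → t j ≈ 0#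
    away j j<n j≢k j≢k+1 = begin
      t j                         ≈⟨ *-congˡ {x = sign j} (*-congˡ (det-equal-adjacent-columns n (punchOut j k) (minor M j)
                                       (suc-punchOut-< j k j<n k+1<n j≢k j≢k+1) same′)) ⟩
      sign j * (M 0 j * 0#)       ≈⟨ *-congˡ (zeroʳ _) ⟩
      sign j * 0#                 ≈⟨ zeroʳ _ ⟩
      0#                          ∎
      where
      same′ : ∀ r → r < n → minor M j r (punchOut j k) ≈ minor M j r (suc (punchOut j k))
      same′ r r<n = begin
        M (suc r) (punchIn j (punchOut j k))         ≡⟨ ≡.cong (M (suc r)) (punchIn-punchOut j k (j≢k ∘ ≡.sym)) ⟩
        M (suc r) k                                  ≈⟨ same (suc r) (s≤s r<n) ⟩
        M (suc r) (suc k)                            ≡⟨ ≡.cong (M (suc r)) (punchIn-suc-punchOut j k j≢k j≢k+1) ⟨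
        M (suc r) (punchIn j (suc (punchOut j k)))   ∎

  det-equal-columns-<′ : ∀ n {a b} M → a ℕ.<′ b → b < n → (∀ r → r < n → M r a ≈ M r b) → det n M ≈ 0#
  det-equal-columns-<′ n M ℕ.<′-base b<n same = det-equal-adjacent-columns n _ M b<n same
  det-equal-columns-<′ n {a} {suc b} M (ℕ.<′-step a<′b) b+1<n same = begin
    det n M                        ≈⟨ -‿involutive _ ⟨
    - - det n M                    ≈⟨ -‿cong (det-swapColumns n b M b+1<n) ⟨
    - det n (swapColumns b M)
      ≈⟨ -‿cong (det-equal-columns-<′ n (swapColumns b M) a<′b (ℕ.<-trans (ℕ.n<1+n b) b+1<n) same′) ⟩
    - 0#                           ≈⟨ -0#≈0# ⟩
    0#                             ∎
    where
    a<b : a < b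
    a<b = ℕ.<′⇒< a<′b
    same′ : ∀ r → r < n → M r (swap b a) ≈ M r (swap b b)
    same′ r r<n = begin
      M r (swap b a)     ≡⟨ ≡.cong (M r) (swap-other b a (ℕ.<⇒≢ a<b) (ℕ.<⇒≢ (ℕ.m<n⇒m<1+n a<b))) ⟩
      M r a              ≈⟨ same r r<n ⟩
      M r (suc b)        ≡⟨ ≡.cong (M r) (swap-k b) ⟨
      M r (swap b b)     ∎

  det-equal-columns : ∀ n {a b} M → a < n → b < n → a ≢ b → (∀ r → r < n → M r a ≈ M r b) → det n M ≈ 0#
  det-equal-columns n M a<n b<n a≢b same with ℕ.<-cmp _ _
  ... | tri< a<b _ _ = det-equal-columns-<′ n M (ℕ.<⇒<′ a<b) b<n same
  ... | tri≈ _ a≡b _ = ⊥-elim (a≢b a≡b)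
  ... | tri> _ _ b<a = det-equal-columns-<′ n M (ℕ.<⇒<′ b<a) a<n (λ r r<n → sym (same r r<n))

  setColumn : Matrix → ℕ → (ℕ → Carrier) → Matrix
  setColumn M k v r c with c ℕ.≟ k
  ... | yes _ = v r
  ... | no  _ = M r c

  setColumn-k : ∀ M k v r → setColumn M k v r k ≡ v r
  setColumn-k M k v r with k ℕ.≟ k
  ... | yes _   = ≡.refl
  ... | no  k≢k = ⊥-elim (k≢k ≡.refl)

  setColumn-≢ : ∀ M k v r c → c ≢ k → setColumn M k v r c ≡ M r c
  setColumn-≢ M k v r c c≢k with c ℕ.≟ k
  ... | yes c≡k = ⊥-elim (c≢k c≡k)
  ... | no  _   = ≡.refl

  setColumn-self : ∀ M k r c → setColumn M k (λ r → M r k) r c ≡ M r c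
  setColumn-self M k r c with c ℕ.≟ k
  ... | yes ≡.refl = ≡.refl
  ... | no  _      = ≡.refl

  det-setColumn-∑ : ∀ n k m M (a : ℕ → Carrier) (v : ℕ → ℕ → Carrier) → k < n →
                    det n (setColumn M k (λ r → ∑[ i < m ] (a i * v i r))) ≈
                    ∑[ i < m ] (a i * det n (setColumn M k (v i)))
  det-setColumn-∑ n k zero    M a v k<n = det-zero-column n k k<n (λ r _ → reflexive (setColumn-k M k _ r))
  det-setColumn-∑ n k (suc m) M a v k<n = begin
    det n (setColumn M k w)
      ≈⟨ det-linear-column n k (a 0) 1# k<n (other-columns w (v 0)) (other-columns w w′) column-k ⟩
    a 0 * det n (setColumn M k (v 0)) + 1# * det n (setColumn M k w′)
      ≈⟨ +-congˡ (trans (*-identityˡ _) (det-setColumn-∑ n k m M (a ∘ suc) (v ∘ suc) k<n)) ⟩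
    ∑[ i < suc m ] (a i * det n (setColumn M k (v i)))  ∎
    where
    w w′ : ℕ → Carrier
    w  r = ∑[ i < suc m ] (a i * v i r)
    w′ r = ∑[ i < m ] (a (suc i) * v (suc i) r)
    other-columns : ∀ u u′ → setColumn M k u ≈[ n ∖ k ] setColumn M k u′
    other-columns u u′ r c _ _ c≢k =
      reflexive (≡.trans (setColumn-≢ M k u r c c≢k) (≡.sym (setColumn-≢ M k u′ r c c≢k)))
    column-k : ∀ r → r < n → setColumn M k w r k ≈ a 0 * setColumn M k (v 0) r k + 1# * setColumn M k w′ r k
    column-k r _ = begin
      setColumn M k w r k                                         ≡⟨ setColumn-k M k w r ⟩
      a 0 * v 0 r + w′ r                                          ≈⟨ +-congˡ (*-identityˡ _) ⟨
      a 0 * v 0 r + 1# * w′ r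
        ≡⟨ ≡.cong₂ (λ x y → a 0 * x + 1# * y) (setColumn-k M k (v 0) r) (setColumn-k M k w′ r) ⟨
      a 0 * setColumn M k (v 0) r k + 1# * setColumn M k w′ r k   ∎

  det-add-columns : ∀ n k M (a : ℕ → Carrier) → k < n → a k ≈ 1# →
                    det n (setColumn M k (λ r → ∑[ i < n ] (a i * M r i))) ≈ det n M
  det-add-columns n k M a k<n ak≈1 = begin
    det n (setColumn M k (λ r → ∑[ i < n ] (a i * M r i)))  ≈⟨ det-setColumn-∑ n k n M a (λ i r → M r i) k<n ⟩
    ∑[ i < n ] (a i * det n (setColumn M k (λ r → M r i)))  ≈⟨ ∑-single n k k<n repeated-column ⟩
    a k * det n (setColumn M k (λ r → M r k))
      ≈⟨ *-cong ak≈1 (det-cong n (λ r c _ _ → reflexive (setColumn-self M k r c))) ⟩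
    1# * det n M                                            ≈⟨ *-identityˡ _ ⟩
    det n M                                                 ∎
    where
    repeated-column : ∀ i → i < n → i ≢ k → a i * det n (setColumn M k (λ r → M r i)) ≈ 0#
    repeated-column i i<n i≢k = trans (*-congˡ (det-equal-columns n _ i<n k<n i≢k (λ r _ →
      reflexive (≡.trans (setColumn-≢ M k _ r i i≢k) (≡.sym (setColumn-k M k _ r)))))) (zeroʳ _)

  mul : ℕ → Matrix → Matrix → Matrix
  mul n A B r c = ∑[ i < n ] (A r i * B i c)

  UpperTriangular : ℕ → Matrix → Set ℓ
  UpperTriangular n M = ∀ r c → c < r → r < n → M r c ≈ 0#

  UnitDiagonal : ℕ → Matrix → Set ℓ
  UnitDiagonal n M = ∀ i → i < n → M i i ≈ 1#

  splice : ℕ → Matrix → Matrix → Matrix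
  splice k A B r c with c ℕ.<? k
  ... | yes _ = A r c
  ... | no  _ = B r c

  splice-< : ∀ {k c} A B r → c < k → splice k A B r c ≡ A r c
  splice-< {k} {c} A B r c<k with c ℕ.<? k
  ... | yes _   = ≡.refl
  ... | no  c≮k = ⊥-elim (c≮k c<k)

  splice-≥ : ∀ {k c} A B r → k ≤ c → splice k A B r c ≡ B r c
  splice-≥ {k} {c} A B r k≤c with c ℕ.<? k
  ... | yes c<k = ⊥-elim (ℕ.<⇒≱ c<k k≤c)
  ... | no  _   = ≡.refl

  splice-suc : ∀ {k c} A B r → c ≢ k → splice (suc k) A B r c ≡ splice k A B r c
  splice-suc {k} {c} A B r c≢k with ℕ.<-cmp c k
  ... | tri< c<k _ _ = ≡.trans (splice-< A B r (ℕ.m<n⇒m<1+n c<k)) (≡.sym (splice-< A B r c<k))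
  ... | tri≈ _ c≡k _ = ⊥-elim (c≢k c≡k)
  ... | tri> _ _ k<c = ≡.trans (splice-≥ A B r k<c) (≡.sym (splice-≥ A B r (ℕ.<⇒≤ k<c)))

  private
    *-zero-both : ∀ {x a y} → a ≈ 0# → x * a ≈ a * y
    *-zero-both a≈0 = trans (*-congˡ a≈0) (trans (zeroʳ _) (sym (trans (*-congʳ a≈0) (zeroˡ _))))

    telescope : ∀ n (f : ℕ → Carrier) → (∀ k → k < n → f k ≈ f (suc k)) → f 0 ≈ f n
    telescope zero    f step = refl
    telescope (suc n) f step = trans (telescope n f (λ k k<n → step k (ℕ.m<n⇒m<1+n k<n))) (step n ℕ.≤-refl)

  -- Column k of M · L is column k of M plus multiples of later columns, so the columns of M · L can
  -- be put in place one at a time, each by a column operation.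
  det-mul-lowerUnitriangular : ∀ n M L → LowerTriangular n L → UnitDiagonal n L → det n (mul n M L) ≈ det n M
  det-mul-lowerUnitriangular n M L lower diag = begin
    det n (mul n M L)  ≈⟨ det-cong n (λ r c _ c<n → reflexive (≡.sym (splice-< (mul n M L) M r c<n))) ⟩
    det n (S n)        ≈⟨ telescope n (det n ∘ S) step ⟨
    det n (S 0)        ≈⟨ det-cong n (λ r c _ _ → reflexive (splice-≥ (mul n M L) M r z≤n)) ⟩
    det n M            ∎
    where
    S : ℕ → Matrix
    S k = splice k (mul n M L) M
    step : ∀ k → k < n → det n (S k) ≈ det n (S (suc k))
    step k k<n = sym (trans (det-cong n S[1+k]≈) (det-add-columns n k (S k) (λ i → L i k) k<n (diag k k<n)))
      where
      S[1+k]≈ : S (suc k) ≈[ n ] setColumn (S k) k (λ r → ∑[ i < n ] (L i k * S k r i))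
      S[1+k]≈ r c _ _ with c ℕ.≟ k
      ... | yes ≡.refl = trans (reflexive (splice-< (mul n M L) M r (ℕ.n<1+n c))) (∑-cong n term)
        where
        term : ∀ i → i < n → M r i * L i c ≈ L i c * S c r i
        term i _ with i ℕ.<? c
        ... | yes i<c = *-zero-both (lower i c i<c k<n)
        ... | no  _   = *-comm _ _
      ... | no  c≢k    = reflexive (splice-suc (mul n M L) M r c≢k)

  det-mul-upperUnitriangular : ∀ n M U → UpperTriangular n U → UnitDiagonal n U → det n (mul n M U) ≈ det n M
  det-mul-upperUnitriangular n M U upper diag = begin
    det n (mul n M U)  ≈⟨ det-cong n (λ r c _ _ → reflexive (≡.sym (splice-≥ M (mul n M U) r z≤n))) ⟩
    det n (S 0)        ≈⟨ telescope n (det n ∘ S) step ⟩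
    det n (S n)        ≈⟨ det-cong n (λ r c _ c<n → reflexive (splice-< M (mul n M U) r c<n)) ⟩
    det n M            ∎
    where
    S : ℕ → Matrix
    S k = splice k M (mul n M U)
    step : ∀ k → k < n → det n (S k) ≈ det n (S (suc k))
    step k k<n = trans (det-cong n S[k]≈) (det-add-columns n k (S (suc k)) (λ i → U i k) k<n (diag k k<n))
      where
      S[k]≈ : S k ≈[ n ] setColumn (S (suc k)) k (λ r → ∑[ i < n ] (U i k * S (suc k) r i))
      S[k]≈ r c _ _ with c ℕ.≟ k
      ... | yes ≡.refl = trans (reflexive (splice-≥ M (mul n M U) r ℕ.≤-refl)) (∑-cong n term)
        where
        term : ∀ i → i < n → M r i * U i c ≈ U i c * S (suc c) r i
        term i i<n with i ℕ.<? suc c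
        ... | yes _   = *-comm _ _
        ... | no  i≰c = *-zero-both (upper i c c<i i<n)
          where c<i = ℕ.≮⇒≥ i≰c
      ... | no  c≢k    = reflexive (≡.sym (splice-suc M (mul n M U) r c≢k))

  _ᵀ : Matrix → Matrix
  (M ᵀ) r c = M c r

  rowMinor : Matrix → ℕ → Matrix
  rowMinor M i r c = M (punchIn i r) (suc c)

  -- Expanding each minor of row 0 along its first column, and each minor of column 0 along its first
  -- row, gives the same double sum.
  det-expand-column : ∀ n M → det (suc n) M ≈ ∑[ i < suc n ] (sign i * (M i 0 * det n (rowMinor M i)))
  det-expand-column zero    M = refl
  det-expand-column (suc n) M = +-congˡ (begin
    ∑[ j < suc n ] (sign (suc j) * (M 0 (suc j) * det (suc n) (minor M (suc j))))
      ≈⟨ ∑-cong (suc n) (λ j _ → *-congˡ {x = sign (suc j)}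
           (*-congˡ {x = M 0 (suc j)} (det-expand-column n (minor M (suc j))))) ⟩
    ∑[ j < suc n ] (sign (suc j) * (M 0 (suc j) * ∑[ i < suc n ] (sign i * (M (suc i) 0 * D i j))))
      ≈⟨ ∑-cong (suc n) (λ j _ → pull-in (sign (suc j)) (M 0 (suc j)) (λ i → sign i * (M (suc i) 0 * D i j))) ⟩
    ∑[ j < suc n ] ∑[ i < suc n ] F i j      ≈⟨ ∑-comm (suc n) (suc n) (λ j i → F i j) ⟩
    ∑[ i < suc n ] ∑[ j < suc n ] F i j
      ≈⟨ ∑-cong (suc n) {f = λ i → ∑ (suc n) (F i)} {g = λ i → ∑ (suc n) (G i)}
           (λ i _ → ∑-cong (suc n) {f = F i} {g = G i} (λ j _ → exchange (sign i) (sign j) _ _ _)) ⟩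
    ∑[ i < suc n ] ∑[ j < suc n ] G i j
      ≈⟨ ∑-cong (suc n) {f = λ i → sign (suc i) * (M (suc i) 0 * det (suc n) (rowMinor M (suc i)))}
                          (λ i _ → pull-in (sign (suc i)) (M (suc i) 0) (λ j → sign j * (M 0 (suc j) * D i j))) ⟨
    ∑[ i < suc n ] (sign (suc i) * (M (suc i) 0 * det (suc n) (rowMinor M (suc i))))  ∎)
    where
    D F G : ℕ → ℕ → Carrier
    D i j = det n (λ r c → M (suc (punchIn i r)) (suc (punchIn j c)))
    F i j = sign (suc j) * (M 0 (suc j) * (sign i * (M (suc i) 0 * D i j)))
    G i j = sign (suc i) * (M (suc i) 0 * (sign j * (M 0 (suc j) * D i j)))
    pull-in : ∀ s m f → s * (m * ∑[ i < suc n ] f i) ≈ ∑[ i < suc n ] (s * (m * f i))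
    pull-in s m f = trans (*-congˡ (*-distribˡ-∑ (suc n) m f)) (*-distribˡ-∑ (suc n) s (λ i → m * f i))
    exchange : ∀ sᵢ sⱼ a b d → - sⱼ * (a * (sᵢ * (b * d))) ≈ - sᵢ * (b * (sⱼ * (a * d)))
    exchange sᵢ sⱼ a b d = begin
      - sⱼ * (a * (sᵢ * (b * d)))      ≈⟨ -‿distribˡ-* sⱼ _ ⟨
      - (sⱼ * (a * (sᵢ * (b * d))))    ≈⟨ -‿cong (reorder sᵢ sⱼ a b d) ⟩
      - (sᵢ * (b * (sⱼ * (a * d))))    ≈⟨ -‿distribˡ-* sᵢ _ ⟩
      - sᵢ * (b * (sⱼ * (a * d)))      ∎
      where
      reorder : ∀ sᵢ sⱼ a b d → sⱼ * (a * (sᵢ * (b * d))) ≈ sᵢ * (b * (sⱼ * (a * d)))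
      reorder = solve 5 (λ sᵢ sⱼ a b d → sⱼ :* (a :* (sᵢ :* (b :* d))) := sᵢ :* (b :* (sⱼ :* (a :* d)))) refl

  det-transpose : ∀ n M → det n (M ᵀ) ≈ det n M
  det-transpose zero    M = refl
  det-transpose (suc n) M = trans
    (∑-cong (suc n) (λ j _ → *-congˡ {x = sign j} (*-congˡ {x = M j 0} (det-transpose n (rowMinor M j)))))
    (sym (det-expand-column n M))

  det-mul-upperUnitriangularˡ : ∀ n U M → UpperTriangular n U → UnitDiagonal n U → det n (mul n U M) ≈ det n M
  det-mul-upperUnitriangularˡ n U M upper diag = begin
    det n (mul n U M)           ≈⟨ det-transpose n (mul n U M) ⟨
    det n (mul n U M ᵀ)         ≈⟨ det-cong n (λ r c _ _ → ∑-cong n (λ i _ → *-comm (U c i) (M i r))) ⟩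
    det n (mul n (M ᵀ) (U ᵀ))
      ≈⟨ det-mul-lowerUnitriangular n (M ᵀ) (U ᵀ) (λ r c r<c c<n → upper c r r<c c<n) diag ⟩
    det n (M ᵀ)                 ≈⟨ det-transpose n M ⟩
    det n M                     ∎

  det-similar : ∀ n {G B C} → UpperTriangular n G → UnitDiagonal n G →
                mul n G B ≈[ n ] mul n C G → det n B ≈ det n C
  det-similar n {G} {B} {C} upper diag GB≈CG = begin
    det n B            ≈⟨ det-mul-upperUnitriangularˡ n G B upper diag ⟨
    det n (mul n G B)  ≈⟨ det-cong n GB≈CG ⟩
    det n (mul n C G)  ≈⟨ det-mul-upperUnitriangular n C G upper diag ⟩
    det n C            ∎

  scalar : Carrier → Matrix
  scalar y r c with r ℕ.≟ c
  ... | yes _ = y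
  ... | no  _ = 0#

  scalar-diagonal : ∀ y r → scalar y r r ≡ y
  scalar-diagonal y r with r ℕ.≟ r
  ... | yes _   = ≡.refl
  ... | no  r≢r = ⊥-elim (r≢r ≡.refl)

  scalar-offDiagonal : ∀ y r c → r ≢ c → scalar y r c ≡ 0#
  scalar-offDiagonal y r c r≢c with r ℕ.≟ c
  ... | yes r≡c = ⊥-elim (r≢c r≡c)
  ... | no  _   = ≡.refl

  charMatrix : Carrier → Matrix → Matrix
  charMatrix y M r c = scalar y r c + - M r c

  mul-charMatrixʳ : ∀ n y A B r c → c < n → mul n A (charMatrix y B) r c ≈ A r c * y + - mul n A B r c
  mul-charMatrixʳ n y A B r c c<n = begin
    ∑[ i < n ] (A r i * (scalar y i c + - B i c))             ≈⟨ ∑-cong n (λ i _ → distrib-neg (A r i) _ _) ⟩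
    ∑[ i < n ] (A r i * scalar y i c + - (A r i * B i c))
      ≈⟨ ∑-distrib-+ n (λ i → A r i * scalar y i c) (λ i → - (A r i * B i c)) ⟩
    ∑[ i < n ] (A r i * scalar y i c) + ∑[ i < n ] (- (A r i * B i c))
      ≈⟨ +-cong (∑-single n c c<n off-diagonal) (∑-neg n (λ i → A r i * B i c)) ⟩
    A r c * scalar y c c + - mul n A B r c
      ≡⟨ ≡.cong (λ x → A r c * x + - mul n A B r c) (scalar-diagonal y c) ⟩
    A r c * y + - mul n A B r c                               ∎
    where
    distrib-neg : ∀ a d b → a * (d + - b) ≈ a * d + - (a * b)
    distrib-neg a d b = trans (distribˡ a d (- b)) (+-congˡ (sym (-‿distribʳ-* a b)))
    off-diagonal : ∀ i → i < n → i ≢ c → A r i * scalar y i c ≈ 0#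
    off-diagonal i _ i≢c = trans (*-congˡ (reflexive (scalar-offDiagonal y i c i≢c))) (zeroʳ _)

  mul-charMatrixˡ : ∀ n y A B r c → r < n → mul n (charMatrix y A) B r c ≈ y * B r c + - mul n A B r c
  mul-charMatrixˡ n y A B r c r<n = begin
    ∑[ i < n ] ((scalar y r i + - A r i) * B i c)             ≈⟨ ∑-cong n (λ i _ → distrib-neg (B i c) _ _) ⟩
    ∑[ i < n ] (scalar y r i * B i c + - (A r i * B i c))
      ≈⟨ ∑-distrib-+ n (λ i → scalar y r i * B i c) (λ i → - (A r i * B i c)) ⟩
    ∑[ i < n ] (scalar y r i * B i c) + ∑[ i < n ] (- (A r i * B i c))
      ≈⟨ +-cong (∑-single n r r<n off-diagonal) (∑-neg n (λ i → A r i * B i c)) ⟩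
    scalar y r r * B r c + - mul n A B r c
      ≡⟨ ≡.cong (λ x → x * B r c + - mul n A B r c) (scalar-diagonal y r) ⟩
    y * B r c + - mul n A B r c                               ∎
    where
    distrib-neg : ∀ b d a → (d + - a) * b ≈ d * b + - (a * b)
    distrib-neg b d a = trans (distribʳ b d (- a)) (+-congˡ (sym (-‿distribˡ-* a b)))
    off-diagonal : ∀ i → i < n → i ≢ r → scalar y r i * B i c ≈ 0#
    off-diagonal i _ i≢r = trans (*-congʳ (reflexive (scalar-offDiagonal y r i (i≢r ∘ ≡.sym)))) (zeroˡ _)

  det-charMatrix-similar : ∀ n y {G B C} → UpperTriangular n G → UnitDiagonal n G →
                           mul n G B ≈[ n ] mul n C G → det n (charMatrix y B) ≈ det n (charMatrix y C)
  det-charMatrix-similar n y {G} {B} {C} upper diag GB≈CG = det-similar n upper diag (λ r c r<n c<n → begin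
    mul n G (charMatrix y B) r c     ≈⟨ mul-charMatrixʳ n y G B r c c<n ⟩
    G r c * y + - mul n G B r c      ≈⟨ +-cong (*-comm _ _) (-‿cong (GB≈CG r c r<n c<n)) ⟩
    y * G r c + - mul n C G r c      ≈⟨ mul-charMatrixˡ n y C G r c r<n ⟨
    mul n (charMatrix y C) G r c     ∎)

  det-charMatrix-lowerTriangular : ∀ n y {T} → LowerTriangular n T →
                                   det n (charMatrix y T) ≈ ∏[ i < n ] (y + - T i i)
  det-charMatrix-lowerTriangular n y {T} lower = begin
    det n (charMatrix y T)               ≈⟨ det-lowerTriangular n lower′ ⟩
    ∏[ i < n ] (scalar y i i + - T i i)  ≈⟨ ∏-cong n (λ i _ → +-congʳ (reflexive (scalar-diagonal y i))) ⟩
    ∏[ i < n ] (y + - T i i)             ∎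
    where
    lower′ : LowerTriangular n (charMatrix y T)
    lower′ r c r<c c<n = begin
      scalar y r c + - T r c
        ≈⟨ +-cong (reflexive (scalar-offDiagonal y r c (ℕ.<⇒≢ r<c))) (-‿cong (lower r c r<c c<n)) ⟩
      0# + - 0#                ≈⟨ -‿inverseʳ 0# ⟩
      0#                       ∎

module ℤ[φ] where

  open import Defs using (Zφ; ⟨_,_⟩; 0φ; 1φ; _+φ_; -φ_; _*φ_)
  open import Data.Integer.Base using (+_; _+_; _*_)
  import Data.Integer.Properties as ℤ
  open import Data.Integer.Tactic.RingSolver using (solve-∀)

  +φ-assoc : ∀ x y z → (x +φ y) +φ z ≡ x +φ (y +φ z)
  +φ-assoc ⟨ a , b ⟩ ⟨ c , d ⟩ ⟨ e , f ⟩ = ≡.cong₂ ⟨_,_⟩ (ℤ.+-assoc a c e) (ℤ.+-assoc b d f)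

  +φ-comm : ∀ x y → x +φ y ≡ y +φ x
  +φ-comm ⟨ a , b ⟩ ⟨ c , d ⟩ = ≡.cong₂ ⟨_,_⟩ (ℤ.+-comm a c) (ℤ.+-comm b d)

  +φ-identityˡ : ∀ x → 0φ +φ x ≡ x
  +φ-identityˡ ⟨ a , b ⟩ = ≡.cong₂ ⟨_,_⟩ (ℤ.+-identityˡ a) (ℤ.+-identityˡ b)

  -φ‿inverseˡ : ∀ x → (-φ x) +φ x ≡ 0φ
  -φ‿inverseˡ ⟨ a , b ⟩ = ≡.cong₂ ⟨_,_⟩ (ℤ.+-inverseˡ a) (ℤ.+-inverseˡ b)

  *φ-assoc : ∀ x y z → (x *φ y) *φ z ≡ x *φ (y *φ z)
  *φ-assoc ⟨ a , b ⟩ ⟨ c , d ⟩ ⟨ e , f ⟩ = ≡.cong₂ ⟨_,_⟩ (re a b c d e f) (im a b c d e f)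
    where
    re : ∀ a b c d e f → (a * c + b * d) * e + (a * d + b * c + b * d) * f
                       ≡ a * (c * e + d * f) + b * (c * f + d * e + d * f)
    re = solve-∀
    im : ∀ a b c d e f → (a * c + b * d) * f + (a * d + b * c + b * d) * e + (a * d + b * c + b * d) * f
                       ≡ a * (c * f + d * e + d * f) + b * (c * e + d * f) + b * (c * f + d * e + d * f)
    im = solve-∀

  *φ-comm : ∀ x y → x *φ y ≡ y *φ x
  *φ-comm ⟨ a , b ⟩ ⟨ c , d ⟩ = ≡.cong₂ ⟨_,_⟩ (re a b c d) (im a b c d)
    where
    re : ∀ a b c d → a * c + b * d ≡ c * a + d * b
    re = solve-∀
    im : ∀ a b c d → a * d + b * c + b * d ≡ c * b + d * a + d * b
    im = solve-∀

  *φ-identityˡ : ∀ x → 1φ *φ x ≡ x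
  *φ-identityˡ ⟨ a , b ⟩ = ≡.cong₂ ⟨_,_⟩ (re a b) (im a b)
    where
    re : ∀ a b → + 1 * a + + 0 * b ≡ a
    re = solve-∀
    im : ∀ a b → + 1 * b + + 0 * a + + 0 * b ≡ b
    im = solve-∀

  *φ-distribˡ : ∀ x y z → x *φ (y +φ z) ≡ (x *φ y) +φ (x *φ z)
  *φ-distribˡ ⟨ a , b ⟩ ⟨ c , d ⟩ ⟨ e , f ⟩ = ≡.cong₂ ⟨_,_⟩ (re a b c d e f) (im a b c d e f)
    where
    re : ∀ a b c d e f → a * (c + e) + b * (d + f) ≡ (a * c + b * d) + (a * e + b * f)
    re = solve-∀
    im : ∀ a b c d e f → a * (d + f) + b * (c + e) + b * (d + f)
                       ≡ (a * d + b * c + b * d) + (a * f + b * e + b * f)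
    im = solve-∀

  Zφ-commutativeRing : CommutativeRing 0ℓ 0ℓ
  Zφ-commutativeRing = record
    { Carrier = Zφ ; _≈_ = _≡_ ; _+_ = _+φ_ ; _*_ = _*φ_ ; -_ = -φ_ ; 0# = 0φ ; 1# = 1φ
    ; isCommutativeRing = record
      { isRing = record
        { +-isAbelianGroup = record
          { isGroup = record
            { isMonoid = record
              { isSemigroup = record
                { isMagma = record { isEquivalence = ≡.isEquivalence ; ∙-cong = ≡.cong₂ _+φ_ }
                ; assoc = +φ-assoc }
              ; identity = comm∧idˡ⇒id +φ-comm +φ-identityˡ }
            ; inverse = comm∧invˡ⇒inv +φ-comm -φ‿inverseˡ
            ; ⁻¹-cong = ≡.cong -φ_ }
          ; comm = +φ-comm }
        ; *-cong = ≡.cong₂ _*φ_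
        ; *-assoc = *φ-assoc
        ; *-identity = comm∧idˡ⇒id *φ-comm *φ-identityˡ
        ; distrib = comm∧distrˡ⇒distr (≡.cong₂ _+φ_) *φ-comm *φ-distribˡ }
      ; *-comm = *φ-comm } }
    where
    open import Algebra.Consequences.Propositional using (comm∧idˡ⇒id; comm∧invˡ⇒inv; comm∧distrˡ⇒distr)

module Polynomial where

  open import Defs using (0φ; 1φ; _+φ_; _*φ_; -φ_; Poly; _+P_; scaleP; _*P_; -P_; constP; X; coeff; _≈P_)
  open import Data.List.Base using ([]; _∷_)
  open ℤ[φ] using (Zφ-commutativeRing)
  open CommutativeRing Zφ-commutativeRing
    using (+-assoc; +-comm; +-identityˡ; +-identityʳ; -‿inverseˡ; *-assoc; *-comm; *-identityˡ; distribˡ; zeroˡ; zeroʳ)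
  open import Algebra.Properties.Ring (CommutativeRing.ring Zφ-commutativeRing) using (-1*x≈-x)
  open import Data.Product.Base using (_,_)
  open import Relation.Binary.Bundles using (Setoid)
  open import Relation.Binary.Structures using (IsEquivalence)
  open ≡.≡-Reasoning

  coeff-+P : ∀ p q i → coeff (p +P q) i ≡ coeff p i +φ coeff q i
  coeff-+P []      q       i       = ≡.sym (+-identityˡ _)
  coeff-+P (a ∷ p) []      i       = ≡.sym (+-identityʳ _)
  coeff-+P (a ∷ p) (b ∷ q) zero    = ≡.refl
  coeff-+P (a ∷ p) (b ∷ q) (suc i) = coeff-+P p q i

  coeff-scaleP : ∀ c p i → coeff (scaleP c p) i ≡ c *φ coeff p i
  coeff-scaleP c []      i       = ≡.sym (zeroʳ c)
  coeff-scaleP c (a ∷ p) zero    = ≡.refl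
  coeff-scaleP c (a ∷ p) (suc i) = coeff-scaleP c p i

  coeff--P : ∀ p i → coeff (-P p) i ≡ -φ coeff p i
  coeff--P p i = ≡.trans (coeff-scaleP (-φ 1φ) p i) (-1*x≈-x _)

  -- A record rather than _≈P_ itself, so that both polynomials can be inferred from an equation.
  infix 4 _≋_
  record _≋_ (p q : Poly) : Set where
    constructor coeffwise
    field same-coeff : p ≈P q
  open _≋_ public

  ≋-refl : ∀ {p} → p ≋ p
  ≋-refl = coeffwise (λ _ → ≡.refl)

  ≋-reflexive : ∀ {p q} → p ≡ q → p ≋ q
  ≋-reflexive ≡.refl = ≋-refl

  ≋-sym : ∀ {p q} → p ≋ q → q ≋ p
  ≋-sym (coeffwise p≈q) = coeffwise (λ i → ≡.sym (p≈q i))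

  ≋-trans : ∀ {p q r} → p ≋ q → q ≋ r → p ≋ r
  ≋-trans (coeffwise p≈q) (coeffwise q≈r) = coeffwise (λ i → ≡.trans (p≈q i) (q≈r i))

  ∷-cong : ∀ {a b p q} → a ≡ b → p ≋ q → (a ∷ p) ≋ (b ∷ q)
  ∷-cong a≡b (coeffwise p≈q) = coeffwise λ where
    zero    → a≡b
    (suc i) → p≈q i

  +P-cong : ∀ {p p′ q q′} → p ≋ p′ → q ≋ q′ → p +P q ≋ p′ +P q′
  +P-cong {p} {p′} {q} {q′} (coeffwise p≈p′) (coeffwise q≈q′) = coeffwise λ i → begin
    coeff (p +P q) i          ≡⟨ coeff-+P p q i ⟩
    coeff p i +φ coeff q i    ≡⟨ ≡.cong₂ _+φ_ (p≈p′ i) (q≈q′ i) ⟩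
    coeff p′ i +φ coeff q′ i  ≡⟨ coeff-+P p′ q′ i ⟨
    coeff (p′ +P q′) i        ∎

  scaleP-cong : ∀ c {p q} → p ≋ q → scaleP c p ≋ scaleP c q
  scaleP-cong c {p} {q} (coeffwise p≈q) = coeffwise λ i → begin
    coeff (scaleP c p) i  ≡⟨ coeff-scaleP c p i ⟩
    c *φ coeff p i        ≡⟨ ≡.cong (c *φ_) (p≈q i) ⟩
    c *φ coeff q i        ≡⟨ coeff-scaleP c q i ⟨
    coeff (scaleP c q) i  ∎

  +P-assoc : ∀ p q r → (p +P q) +P r ≋ p +P (q +P r)
  +P-assoc p q r = coeffwise λ i → begin
    coeff ((p +P q) +P r) i                     ≡⟨ coeff-+P (p +P q) r i ⟩
    coeff (p +P q) i +φ coeff r i               ≡⟨ ≡.cong (_+φ coeff r i) (coeff-+P p q i) ⟩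
    (coeff p i +φ coeff q i) +φ coeff r i       ≡⟨ +-assoc (coeff p i) (coeff q i) (coeff r i) ⟩
    coeff p i +φ (coeff q i +φ coeff r i)       ≡⟨ ≡.cong (coeff p i +φ_) (coeff-+P q r i) ⟨
    coeff p i +φ coeff (q +P r) i               ≡⟨ coeff-+P p (q +P r) i ⟨
    coeff (p +P (q +P r)) i                     ∎

  +P-comm : ∀ p q → p +P q ≋ q +P p
  +P-comm p q = coeffwise λ i → begin
    coeff (p +P q) i         ≡⟨ coeff-+P p q i ⟩
    coeff p i +φ coeff q i   ≡⟨ +-comm (coeff p i) (coeff q i) ⟩
    coeff q i +φ coeff p i   ≡⟨ coeff-+P q p i ⟨
    coeff (q +P p) i         ∎

  +P-identityˡ : ∀ p → [] +P p ≋ p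
  +P-identityˡ p = ≋-refl

  -P‿inverseˡ : ∀ p → (-P p) +P p ≋ []
  -P‿inverseˡ p = coeffwise λ i → begin
    coeff ((-P p) +P p) i          ≡⟨ coeff-+P (-P p) p i ⟩
    coeff (-P p) i +φ coeff p i    ≡⟨ ≡.cong (_+φ coeff p i) (coeff--P p i) ⟩
    (-φ coeff p i) +φ coeff p i    ≡⟨ -‿inverseˡ (coeff p i) ⟩
    0φ                             ∎

  -P-cong : ∀ {p q} → p ≋ q → -P p ≋ -P q
  -P-cong = scaleP-cong (-φ 1φ)

  scaleP-distrib-+P : ∀ c p q → scaleP c (p +P q) ≋ scaleP c p +P scaleP c q
  scaleP-distrib-+P c p q = coeffwise λ i → begin
    coeff (scaleP c (p +P q)) i                          ≡⟨ coeff-scaleP c (p +P q) i ⟩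
    c *φ coeff (p +P q) i                                ≡⟨ ≡.cong (c *φ_) (coeff-+P p q i) ⟩
    c *φ (coeff p i +φ coeff q i)                        ≡⟨ distribˡ c (coeff p i) (coeff q i) ⟩
    c *φ coeff p i +φ c *φ coeff q i                     ≡⟨ ≡.cong₂ _+φ_ (coeff-scaleP c p i) (coeff-scaleP c q i) ⟨
    coeff (scaleP c p) i +φ coeff (scaleP c q) i         ≡⟨ coeff-+P (scaleP c p) (scaleP c q) i ⟨
    coeff (scaleP c p +P scaleP c q) i                   ∎

  scaleP-*P : ∀ a q r → (scaleP a q) *P r ≋ scaleP a (q *P r)
  scaleP-*P a []      r = ≋-refl
  scaleP-*P a (b ∷ q) r = ≋-trans
    (+P-cong {scaleP (a *φ b) r} {scaleP a (scaleP b r)} (coeffwise λ i → begin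
                coeff (scaleP (a *φ b) r) i   ≡⟨ coeff-scaleP (a *φ b) r i ⟩
                (a *φ b) *φ coeff r i         ≡⟨ *-assoc a b (coeff r i) ⟩
                a *φ (b *φ coeff r i)         ≡⟨ ≡.cong (a *φ_) (coeff-scaleP b r i) ⟨
                a *φ coeff (scaleP b r) i     ≡⟨ coeff-scaleP a (scaleP b r) i ⟨
                coeff (scaleP a (scaleP b r)) i ∎)
             (∷-cong (≡.sym (zeroʳ a)) (scaleP-*P a q r)))
    (≋-sym (scaleP-distrib-+P a (scaleP b r) (0φ ∷ (q *P r))))

  *P-congʳ : ∀ p {q q′} → q ≋ q′ → p *P q ≋ p *P q′
  *P-congʳ []      q≋q′ = ≋-refl
  *P-congʳ (a ∷ p) q≋q′ = +P-cong (scaleP-cong a q≋q′) (∷-cong ≡.refl (*P-congʳ p q≋q′))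

  *P-zeroʳ : ∀ p → p *P [] ≋ []
  *P-zeroʳ []      = ≋-refl
  *P-zeroʳ (a ∷ p) = ≋-trans (∷-cong ≡.refl (*P-zeroʳ p)) (coeffwise λ where
    zero    → ≡.refl
    (suc i) → ≡.refl)

  +P-left-comm : ∀ p q r → p +P (q +P r) ≋ q +P (p +P r)
  +P-left-comm p q r =
    ≋-trans (≋-sym (+P-assoc p q r)) (≋-trans (+P-cong (+P-comm p q) (≋-refl {r})) (+P-assoc q p r))

  +P-interchange : ∀ p q r s → (p +P q) +P (r +P s) ≋ (p +P r) +P (q +P s)
  +P-interchange p q r s = ≋-trans (+P-assoc p q (r +P s))
    (≋-trans (+P-cong (≋-refl {p}) (+P-left-comm q r s)) (≋-sym (+P-assoc p r (q +P s))))

  *P-∷ʳ : ∀ p b q → p *P (b ∷ q) ≋ scaleP b p +P (0φ ∷ (p *P q))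
  *P-∷ʳ []      b q = coeffwise λ where
    zero    → ≡.refl
    (suc i) → ≡.refl
  *P-∷ʳ (a ∷ p) b q = ∷-cong (≡.cong (_+φ 0φ) (*-comm a b))
    (≋-trans (+P-cong (≋-refl {scaleP a q}) (*P-∷ʳ p b q)) (+P-left-comm (scaleP a q) (scaleP b p) (0φ ∷ (p *P q))))

  *P-comm : ∀ p q → p *P q ≋ q *P p
  *P-comm []      q = ≋-sym (*P-zeroʳ q)
  *P-comm (a ∷ p) q = ≋-trans (+P-cong (≋-refl {scaleP a q}) (∷-cong ≡.refl (*P-comm p q))) (≋-sym (*P-∷ʳ q a p))

  *P-cong : ∀ {p p′ q q′} → p ≋ p′ → q ≋ q′ → p *P q ≋ p′ *P q′
  *P-cong {p} {p′} {q} {q′} p≋p′ q≋q′ =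
    ≋-trans (*P-comm p q) (≋-trans (*P-congʳ q p≋p′) (≋-trans (*P-comm q p′) (*P-congʳ p′ q≋q′)))

  *P-distribˡ : ∀ p q r → p *P (q +P r) ≋ (p *P q) +P (p *P r)
  *P-distribˡ []      q r = ≋-refl
  *P-distribˡ (a ∷ p) q r = ≋-trans
    (+P-cong (scaleP-distrib-+P a q r) (∷-cong (≡.sym (+-identityˡ 0φ)) (*P-distribˡ p q r)))
    (+P-interchange (scaleP a q) (scaleP a r) (0φ ∷ (p *P q)) (0φ ∷ (p *P r)))

  *P-distribʳ : ∀ p q r → (q +P r) *P p ≋ (q *P p) +P (r *P p)
  *P-distribʳ p q r =
    ≋-trans (*P-comm (q +P r) p) (≋-trans (*P-distribˡ p q r) (+P-cong (*P-comm p q) (*P-comm p r)))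

  scaleP-zero : ∀ p → scaleP 0φ p ≋ []
  scaleP-zero p = coeffwise λ i → ≡.trans (coeff-scaleP 0φ p i) (zeroˡ (coeff p i))

  *P-assoc : ∀ p q r → (p *P q) *P r ≋ p *P (q *P r)
  *P-assoc []      q r = ≋-refl
  *P-assoc (a ∷ p) q r = ≋-trans (*P-distribʳ r (scaleP a q) (0φ ∷ (p *P q)))
    (+P-cong (scaleP-*P a q r) (≋-trans (+P-cong (scaleP-zero r) ≋-refl) (∷-cong ≡.refl (*P-assoc p q r))))

  coeff-constP-*P : ∀ a p i → coeff (constP a *P p) i ≡ a *φ coeff p i
  coeff-constP-*P a p i = begin
    coeff (scaleP a p +P (0φ ∷ [])) i         ≡⟨ coeff-+P (scaleP a p) (0φ ∷ []) i ⟩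
    coeff (scaleP a p) i +φ coeff (0φ ∷ []) i ≡⟨ ≡.cong₂ _+φ_ (coeff-scaleP a p i) (coeff-0∷[] i) ⟩
    a *φ coeff p i +φ 0φ                      ≡⟨ +-identityʳ (a *φ coeff p i) ⟩
    a *φ coeff p i                            ∎
    where
    coeff-0∷[] : ∀ i → coeff (0φ ∷ []) i ≡ 0φ
    coeff-0∷[] zero    = ≡.refl
    coeff-0∷[] (suc i) = ≡.refl

  *P-identityˡ : ∀ p → constP 1φ *P p ≋ p
  *P-identityˡ p = coeffwise λ i → ≡.trans (coeff-constP-*P 1φ p i) (*-identityˡ (coeff p i))

  coeff-X*P-zero : ∀ p → coeff (X *P p) zero ≡ 0φ
  coeff-X*P-zero p = begin
    coeff (scaleP 0φ p +P (0φ ∷ (constP 1φ *P p))) zero   ≡⟨ coeff-+P (scaleP 0φ p) (0φ ∷ (constP 1φ *P p)) zero ⟩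
    coeff (scaleP 0φ p) zero +φ 0φ                        ≡⟨ +-identityʳ (coeff (scaleP 0φ p) zero) ⟩
    coeff (scaleP 0φ p) zero                              ≡⟨ coeff-scaleP 0φ p zero ⟩
    0φ *φ coeff p zero                                    ≡⟨ zeroˡ (coeff p zero) ⟩
    0φ                                                    ∎

  coeff-X*P-suc : ∀ p t → coeff (X *P p) (suc t) ≡ coeff p t
  coeff-X*P-suc p t = begin
    coeff (scaleP 0φ p +P (0φ ∷ (constP 1φ *P p))) (suc t)        ≡⟨ coeff-+P (scaleP 0φ p) (0φ ∷ (constP 1φ *P p)) (suc t) ⟩
    coeff (scaleP 0φ p) (suc t) +φ coeff (constP 1φ *P p) t      ≡⟨ ≡.cong₂ _+φ_ (≡.trans (coeff-scaleP 0φ p (suc t)) (zeroˡ (coeff p (suc t))))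
                                                                                 (same-coeff (*P-identityˡ p) t) ⟩
    0φ +φ coeff p t                                              ≡⟨ +-identityˡ (coeff p t) ⟩
    coeff p t                                                    ∎

  ≋-isEquivalence : IsEquivalence _≋_
  ≋-isEquivalence = record { refl = ≋-refl ; sym = ≋-sym ; trans = ≋-trans }

  ≋-setoid : Setoid 0ℓ 0ℓ
  ≋-setoid = record { isEquivalence = ≋-isEquivalence }

  Poly-commutativeRing : CommutativeRing 0ℓ 0ℓ
  Poly-commutativeRing = record
    { Carrier = Poly ; _≈_ = _≋_ ; _+_ = _+P_ ; _*_ = _*P_ ; -_ = -P_ ; 0# = [] ; 1# = constP 1φ
    ; isCommutativeRing = record
      { isRing = record
        { +-isAbelianGroup = record
          { isGroup = record
            { isMonoid = record
              { isSemigroup = record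
                { isMagma = record { isEquivalence = ≋-isEquivalence ; ∙-cong = +P-cong }
                ; assoc = +P-assoc }
              ; identity = comm∧idˡ⇒id +P-comm +P-identityˡ }
            ; inverse = comm∧invˡ⇒inv +P-comm -P‿inverseˡ
            ; ⁻¹-cong = -P-cong }
          ; comm = +P-comm }
        ; *-cong = *P-cong
        ; *-assoc = *P-assoc
        ; *-identity = comm∧idˡ⇒id *P-comm *P-identityˡ
        ; distrib = *P-distribˡ , *P-distribʳ }
      ; *-comm = *P-comm } }
    where
    open import Algebra.Consequences.Setoid ≋-setoid using (comm∧idˡ⇒id; comm∧invˡ⇒inv)

module RowPolynomial where

  open import Defs using (Zφ; 0φ; 1φ; _+φ_; _*φ_; _^φ_; fromℕφ; Poly; _+P_; _*P_; constP; X; coeff)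
  open import Data.List.Base using ([])
  open import Function.Base using (_∘_)
  open import Data.Empty using (⊥-elim)
  open ℤ[φ] using (Zφ-commutativeRing)
  open Polynomial
  open BigOperators Poly-commutativeRing
  open import Algebra.Properties.Semiring.Mult (CommutativeRing.semiring Poly-commutativeRing) using (_×_)
  private
    module ZφRing where
      open CommutativeRing Zφ-commutativeRing public
      open BigOperators Zφ-commutativeRing public
  open CommutativeRing Poly-commutativeRing using (setoid; *-assoc; *-congʳ; distribʳ)
  open import Relation.Binary.Reasoning.Setoid setoid

  constP-cong : ∀ {x y} → x ≡ y → constP x ≋ constP y
  constP-cong ≡.refl = ≋-refl

  constP-0 : constP 0φ ≋ []
  constP-0 = coeffwise λ where
    zero    → ≡.refl
    (suc i) → ≡.refl

  constP-* : ∀ x y → constP (x *φ y) ≋ constP x *P constP y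
  constP-* x y = coeffwise λ where
    zero    → ≡.sym (ZφRing.+-identityʳ (x *φ y))
    (suc i) → ≡.refl

  constP-∑ : ∀ n f → constP (ZφRing.∑ n f) ≋ ∑[ i < n ] constP (f i)
  constP-∑ zero    f = constP-0
  constP-∑ (suc n) f = +P-cong (≋-refl {constP (f 0)}) (constP-∑ n (f ∘ suc))

  constP-^ : ∀ x n → constP (x ^φ n) ≋ constP x ^ n
  constP-^ x zero    = ≋-refl
  constP-^ x (suc n) = ≋-trans (constP-* x (x ^φ n)) (*P-cong (≋-refl {constP x}) (constP-^ x n))

  constP-fromℕφ-*P : ∀ n p → constP (fromℕφ n) *P p ≋ n × p
  constP-fromℕφ-*P zero    p = *P-cong constP-0 (≋-refl {p})
  constP-fromℕφ-*P (suc n) p = begin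
    (constP 1φ +P constP (fromℕφ n)) *P p            ≈⟨ distribʳ p (constP 1φ) (constP (fromℕφ n)) ⟩
    (constP 1φ *P p) +P (constP (fromℕφ n) *P p)     ≈⟨ +P-cong (*P-identityˡ p) (constP-fromℕφ-*P n p) ⟩
    p +P (n × p)                                     ∎

  coeff-∑ : ∀ n f t → coeff (∑ n f) t ≡ ZφRing.∑ n (λ j → coeff (f j) t)
  coeff-∑ zero    f t = ≡.refl
  coeff-∑ (suc n) f t =
    ≡.trans (coeff-+P (f 0) (∑ n (f ∘ suc)) t) (≡.cong (coeff (f 0) t +φ_) (coeff-∑ n (f ∘ suc) t))

  coeff-X^-diagonal : ∀ k → coeff (X ^ k) k ≡ 1φ
  coeff-X^-diagonal zero    = ≡.refl
  coeff-X^-diagonal (suc k) = ≡.trans (coeff-X*P-suc (X ^ k) k) (coeff-X^-diagonal k)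

  coeff-X^-offDiagonal : ∀ k t → k ≢ t → coeff (X ^ k) t ≡ 0φ
  coeff-X^-offDiagonal zero    zero    k≢t = ⊥-elim (k≢t ≡.refl)
  coeff-X^-offDiagonal zero    (suc t) _   = ≡.refl
  coeff-X^-offDiagonal (suc k) zero    _   = coeff-X*P-zero (X ^ k)
  coeff-X^-offDiagonal (suc k) (suc t) k≢t =
    ≡.trans (coeff-X*P-suc (X ^ k) t) (coeff-X^-offDiagonal k t (k≢t ∘ ≡.cong suc))

  rowPoly : ℕ → (ℕ → Zφ) → Poly
  rowPoly N v = ∑[ s < N ] (constP (v (N ∸ suc s)) *P (X ^ s))

  reflect-reflect : ∀ {N j} → j < N → N ∸ suc (N ∸ suc j) ≡ j
  reflect-reflect {suc N} (s≤s j≤N) = ℕ.m∸[m∸n]≡n j≤N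

  reflect-< : ∀ {N j} → j < N → N ∸ suc j < N
  reflect-< {suc N} {j} _ = s≤s (ℕ.m∸n≤m N j)

  coeff-rowPoly : ∀ N v t → t < N → coeff (rowPoly N v) t ≡ v (N ∸ suc t)
  coeff-rowPoly N v t t<N =
    ≡.trans (coeff-∑ N (λ s → constP (v (N ∸ suc s)) *P (X ^ s)) t)
   (≡.trans (ZφRing.∑-single N t t<N off-diagonal)
   (≡.trans (coeff-constP-*P (v (N ∸ suc t)) (X ^ t) t)
   (≡.trans (≡.cong (v (N ∸ suc t) *φ_) (coeff-X^-diagonal t))
            (ZφRing.*-identityʳ (v (N ∸ suc t))))))
    where
    off-diagonal : ∀ s → s < N → s ≢ t → coeff (constP (v (N ∸ suc s)) *P (X ^ s)) t ≡ 0φ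
    off-diagonal s _ s≢t = ≡.trans (coeff-constP-*P (v (N ∸ suc s)) (X ^ s) t)
      (≡.trans (≡.cong (v (N ∸ suc s) *φ_) (coeff-X^-offDiagonal s t s≢t)) (ZφRing.zeroʳ (v (N ∸ suc s))))

  rowPoly-injective : ∀ N {v w} → rowPoly N v ≋ rowPoly N w → ∀ j → j < N → v j ≡ w j
  rowPoly-injective N {v} {w} v≋w j j<N = ≡.subst (λ i → v i ≡ w i) (reflect-reflect j<N)
    (≡.trans (≡.sym (coeff-rowPoly N v t (reflect-< j<N)))
    (≡.trans (same-coeff v≋w t) (coeff-rowPoly N w t (reflect-< j<N))))
    where
    t = N ∸ suc j

  rowPoly-linear : ∀ N M (w : ℕ → Zφ) (B : ℕ → ℕ → Zφ) →
                   rowPoly N (λ c → ZφRing.∑ M (λ m → w m *φ B m c)) ≋ ∑[ m < M ] (constP (w m) *P rowPoly N (B m))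
  rowPoly-linear N M w B = begin
    ∑[ s < N ] (constP (ZφRing.∑ M (λ m → w m *φ B m (N ∸ suc s))) *P (X ^ s))  ≈⟨ ∑-cong N (λ s _ → expand s) ⟩
    ∑[ s < N ] ∑[ m < M ] F m s                                              ≈⟨ ∑-comm N M (λ s m → F m s) ⟩
    ∑[ m < M ] ∑[ s < N ] F m s
      ≈⟨ ∑-cong M {f = λ m → constP (w m) *P rowPoly N (B m)}
           (λ m _ → *-distribˡ-∑ N (constP (w m)) (λ s → constP (B m (N ∸ suc s)) *P (X ^ s))) ⟨
    ∑[ m < M ] (constP (w m) *P rowPoly N (B m))                              ∎
    where
    F : ℕ → ℕ → Poly
    F m s = constP (w m) *P (constP (B m (N ∸ suc s)) *P (X ^ s))
    expand : ∀ s → constP (ZφRing.∑ M (λ m → w m *φ B m (N ∸ suc s))) *P (X ^ s) ≋ ∑[ m < M ] F m s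
    expand s = begin
      constP (ZφRing.∑ M (λ m → w m *φ B m (N ∸ suc s))) *P (X ^ s)
        ≈⟨ *-congʳ {x = X ^ s} (constP-∑ M (λ m → w m *φ B m (N ∸ suc s))) ⟩
      (∑[ m < M ] constP (w m *φ B m (N ∸ suc s))) *P (X ^ s)
        ≈⟨ *-distribʳ-∑ M (X ^ s) (λ m → constP (w m *φ B m (N ∸ suc s))) ⟩
      ∑[ m < M ] (constP (w m *φ B m (N ∸ suc s)) *P (X ^ s))
        ≈⟨ ∑-cong M (λ m _ → ≋-trans (*-congʳ {x = X ^ s} (constP-* (w m) (B m (N ∸ suc s))))
                                     (*-assoc (constP (w m)) (constP (B m (N ∸ suc s))) (X ^ s))) ⟩
      ∑[ m < M ] F m s ∎

module RowArithmetic {N r a : ℕ} (N≡1+r+a : N ≡ suc (r ℕ.+ a)) where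

  open ≡.≡-Reasoning

  a<N : a < N
  a<N = ≡.subst (a <_) (≡.sym N≡1+r+a) (s≤s (ℕ.m≤n+m a r))

  r<N : r < N
  r<N = ≡.subst (r <_) (≡.sym N≡1+r+a) (s≤s (ℕ.m≤m+n r a))

  N∸1+r≡a : N ∸ suc r ≡ a
  N∸1+r≡a = ≡.trans (≡.cong (_∸ suc r) N≡1+r+a) (ℕ.m+n∸m≡n r a)

  [N∸1+s]∸r≡a∸s : ∀ s → (N ∸ suc s) ∸ r ≡ a ∸ s
  [N∸1+s]∸r≡a∸s s = begin
    (N ∸ suc s) ∸ r            ≡⟨ ≡.cong (λ n → (n ∸ suc s) ∸ r) N≡1+r+a ⟩
    (r ℕ.+ a ∸ s) ∸ r          ≡⟨ ℕ.∸-+-assoc (r ℕ.+ a) s r ⟩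
    r ℕ.+ a ∸ (s ℕ.+ r)        ≡⟨ ≡.cong (r ℕ.+ a ∸_) (ℕ.+-comm s r) ⟩
    r ℕ.+ a ∸ (r ℕ.+ s)        ≡⟨ ℕ.[m+n]∸[m+o]≡n∸o r a s ⟩
    a ∸ s                      ∎

  N∸1+s≡r+[a∸s] : ∀ {s} → s ≤ a → N ∸ suc s ≡ r ℕ.+ (a ∸ s)
  N∸1+s≡r+[a∸s] s≤a = ≡.trans (≡.cong (_∸ suc _) N≡1+r+a) (ℕ.+-∸-assoc r s≤a)

  N∸1+s≡a+[r∸s] : ∀ {s} → s ≤ r → N ∸ suc s ≡ a ℕ.+ (r ∸ s)
  N∸1+s≡a+[r∸s] s≤r = ≡.trans (≡.cong (_∸ suc _) N≡1+r+a) (≡.trans (ℕ.+-∸-comm a s≤r) (ℕ.+-comm _ a))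

module BinomialMatrices where

  open import Defs using (Zφ; 0φ; 1φ; φ; φ̄; _*φ_; _^φ_; fromℕφ; Poly; constP; X)
  open import Data.Nat.Combinatorics using (_C_; nCn≡1; k>n⇒nCk≡0)
  open ℤ[φ] using (Zφ-commutativeRing)
  open Polynomial using (_≋_; Poly-commutativeRing)
  open RowPolynomial
  open CommutativeRing Poly-commutativeRing hiding (zero)
  open BigOperators Poly-commutativeRing
  open import Algebra.Properties.Semiring.Mult semiring using (_×_; ×-congʳ; ×-comm-*)
  open import Algebra.Properties.Semiring.Exp semiring using (^-congˡ; ^-homo-*)
  open import Algebra.Properties.CommutativeSemiring.Exp commutativeSemiring using (^-distrib-*)
  open import Algebra.Properties.CommutativeSemigroup +-commutativeSemigroup using (x∙yz≈y∙xz)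
  open import Algebra.Properties.CommutativeSemigroup *-commutativeSemigroup using (interchange)
  private
    module ZφRing where
      open CommutativeRing Zφ-commutativeRing public
      open Determinant Zφ-commutativeRing public
  open import Relation.Binary.Reasoning.Setoid setoid

  -- A N is R_N.  The entry C(N−1−r, N−1−m) of G N equals C(N−1−r, m−r) when r ≤ m and vanishes when
  -- m < r, so G N is upper unitriangular without a case split on r ≤ m.
  A G T : ℕ → ℕ → ℕ → Zφ
  A N m c = fromℕφ (m C (N ∸ suc c))
  G N r m = fromℕφ ((N ∸ suc r) C (N ∸ suc m)) *φ φ ^φ (m ∸ r)
  T N r s = fromℕφ (r C s) *φ (φ ^φ (N ∸ suc r) *φ φ̄ ^φ s)

  Φ Φ̄ : Poly
  Φ = constP φ
  Φ̄ = constP φ̄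

  Φ*Φ≈Φ+1 : Φ * Φ ≈ Φ + 1#
  Φ*Φ≈Φ+1 = Polynomial.≋-sym (constP-* φ φ)

  row-split : ∀ {N r} → r < N → N ≡ suc (r ℕ.+ (N ∸ suc r))
  row-split {suc N} {r} (s≤s r≤N) = ≡.cong suc (≡.sym (ℕ.m+[n∸m]≡n r≤N))

  constP-C≈0 : ∀ {n s} c → n < s → constP (fromℕφ (n C s) *φ c) ≈ 0#
  constP-C≈0 {n} {s} c n<s = begin
    constP (fromℕφ (n C s) *φ c)   ≡⟨ ≡.cong (λ k → constP (fromℕφ k *φ c)) (k>n⇒nCk≡0 n<s) ⟩
    constP (0φ *φ c)               ≡⟨ ≡.cong constP (ZφRing.zeroˡ c) ⟩
    constP 0φ                      ≈⟨ constP-0 ⟩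
    0#                             ∎

  constP-C-*≈0 : ∀ {n s} c x → n < s → constP (fromℕφ (n C s) *φ c) * x ≈ 0#
  constP-C-*≈0 c x n<s = trans (*-congʳ {x = x} (constP-C≈0 c n<s)) (zeroˡ x)

  constP-C-* : ∀ n s c x → constP (fromℕφ (n C s) *φ c) * x ≈ (n C s) × (x * constP c)
  constP-C-* n s c x = begin
    constP (fromℕφ (n C s) *φ c) * x          ≈⟨ *-congʳ {x = x} (constP-* (fromℕφ (n C s)) c) ⟩
    (constP (fromℕφ (n C s)) * constP c) * x  ≈⟨ *-assoc (constP (fromℕφ (n C s))) (constP c) x ⟩
    constP (fromℕφ (n C s)) * (constP c * x)  ≈⟨ *-congˡ {x = constP (fromℕφ (n C s))} (*-comm (constP c) x) ⟩
    constP (fromℕφ (n C s)) * (x * constP c)  ≈⟨ constP-fromℕφ-*P (n C s) _ ⟩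
    (n C s) × (x * constP c)                  ∎

  rowPoly-A : ∀ {N m} → m < N → rowPoly N (A N m) ≈ (X + 1#) ^ m
  rowPoly-A {N} {m} m<N = begin
    rowPoly N (A N m)    ≈⟨ ∑-binomial 1# X 1# (λ s → constP (A N m (N ∸ suc s)) * X ^ s) m<N vanish term ⟩
    1# * (X + 1#) ^ m    ≈⟨ *-identityˡ _ ⟩
    (X + 1#) ^ m         ∎
    where
    vanish : ∀ s → m < s → s < N → constP (A N m (N ∸ suc s)) * X ^ s ≈ 0#
    vanish s m<s s<N = begin
      constP (A N m (N ∸ suc s)) * X ^ s
        ≡⟨ ≡.cong (λ z → constP z * X ^ s) (ZφRing.*-identityʳ (A N m (N ∸ suc s))) ⟨
      constP (A N m (N ∸ suc s) *φ 1φ) * X ^ s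
        ≈⟨ constP-C-*≈0 1φ (X ^ s) (≡.subst (m <_) (≡.sym (reflect-reflect s<N)) m<s) ⟩
      0#                                          ∎
    term : ∀ s → s ≤ m → constP (A N m (N ∸ suc s)) * X ^ s ≈ 1# * ((m C s) × (X ^ s * 1# ^ (m ∸ s)))
    term s s≤m = begin
      constP (A N m (N ∸ suc s)) * X ^ s
        ≡⟨ ≡.cong (λ t → constP (fromℕφ (m C t)) * X ^ s) (reflect-reflect (ℕ.≤-<-trans s≤m m<N)) ⟩
      constP (fromℕφ (m C s)) * X ^ s         ≈⟨ constP-fromℕφ-*P (m C s) (X ^ s) ⟩
      (m C s) × X ^ s
        ≈⟨ ×-congʳ (m C s) (trans (*-congˡ {x = X ^ s} (1#^n≈1# (m ∸ s))) (*-identityʳ (X ^ s))) ⟨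
      (m C s) × (X ^ s * 1# ^ (m ∸ s))        ≈⟨ *-identityˡ _ ⟨
      1# * ((m C s) × (X ^ s * 1# ^ (m ∸ s))) ∎

  G-reflected : ∀ {N r a} → N ≡ suc (r ℕ.+ a) → ∀ s → s < N →
                G N r (N ∸ suc s) ≡ fromℕφ (a C s) *φ φ ^φ (a ∸ s)
  G-reflected {N} {r} {a} N≡1+r+a s s<N =
    ≡.trans (≡.cong (λ e → fromℕφ ((N ∸ suc r) C (N ∸ suc (N ∸ suc s))) *φ φ ^φ e) ([N∸1+s]∸r≡a∸s s))
            (≡.cong₂ (λ n t → fromℕφ (n C t) *φ φ ^φ (a ∸ s)) N∸1+r≡a (reflect-reflect s<N))
    where open RowArithmetic {N} {r} {a} N≡1+r+a

  rowPoly-G : ∀ {N r a} → N ≡ suc (r ℕ.+ a) → rowPoly N (G N r) ≈ (X + Φ) ^ a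
  rowPoly-G {N} {r} {a} N≡1+r+a = begin
    rowPoly N (G N r)    ≈⟨ ∑-binomial 1# X Φ (λ s → constP (G N r (N ∸ suc s)) * X ^ s) a<N vanish term ⟩
    1# * (X + Φ) ^ a     ≈⟨ *-identityˡ _ ⟩
    (X + Φ) ^ a          ∎
    where
    open RowArithmetic {N} {r} {a} N≡1+r+a
    vanish : ∀ s → a < s → s < N → constP (G N r (N ∸ suc s)) * X ^ s ≈ 0#
    vanish s a<s s<N = trans (reflexive (≡.cong (λ z → constP z * X ^ s) (G-reflected N≡1+r+a s s<N)))
                             (constP-C-*≈0 _ (X ^ s) a<s)
    term : ∀ s → s ≤ a → constP (G N r (N ∸ suc s)) * X ^ s ≈ 1# * ((a C s) × (X ^ s * Φ ^ (a ∸ s)))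
    term s s≤a = begin
      constP (G N r (N ∸ suc s)) * X ^ s
        ≡⟨ ≡.cong (λ z → constP z * X ^ s) (G-reflected N≡1+r+a s (ℕ.≤-<-trans s≤a a<N)) ⟩
      constP (fromℕφ (a C s) *φ φ ^φ (a ∸ s)) * X ^ s         ≈⟨ constP-C-* a s (φ ^φ (a ∸ s)) (X ^ s) ⟩
      (a C s) × (X ^ s * constP (φ ^φ (a ∸ s)))               ≈⟨ ×-congʳ (a C s) (*-congˡ {x = X ^ s} (constP-^ φ (a ∸ s))) ⟩
      (a C s) × (X ^ s * Φ ^ (a ∸ s))                         ≈⟨ *-identityˡ _ ⟨
      1# * ((a C s) × (X ^ s * Φ ^ (a ∸ s)))                  ∎

  rowPoly-GA : ∀ {N r a} → N ≡ suc (r ℕ.+ a) →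
               rowPoly N (ZφRing.mul N (G N) (A N) r) ≈ (X + 1#) ^ r * (1# + Φ * (X + 1#)) ^ a
  rowPoly-GA {N} {r} {a} N≡1+r+a = begin
    rowPoly N (ZφRing.mul N (G N) (A N) r)                    ≈⟨ rowPoly-linear N N (G N r) (A N) ⟩
    ∑[ m < N ] (constP (G N r m) * rowPoly N (A N m))
      ≈⟨ ∑-cong N (λ m m<N → *-congˡ {x = constP (G N r m)} (rowPoly-A m<N)) ⟩
    ∑[ m < N ] (constP (G N r m) * W ^ m)                     ≈⟨ ∑-reverse N (λ m → constP (G N r m) * W ^ m) ⟨
    ∑[ u < N ] (constP (G N r (N ∸ suc u)) * W ^ (N ∸ suc u))
      ≈⟨ ∑-binomial (W ^ r) 1# (Φ * W) (λ u → constP (G N r (N ∸ suc u)) * W ^ (N ∸ suc u)) a<N vanish term ⟩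
    W ^ r * (1# + Φ * W) ^ a                                  ∎
    where
    open RowArithmetic {N} {r} {a} N≡1+r+a
    W = X + 1#
    vanish : ∀ u → a < u → u < N → constP (G N r (N ∸ suc u)) * W ^ (N ∸ suc u) ≈ 0#
    vanish u a<u u<N = trans (reflexive (≡.cong (λ z → constP z * W ^ (N ∸ suc u)) (G-reflected N≡1+r+a u u<N)))
                             (constP-C-*≈0 _ (W ^ (N ∸ suc u)) a<u)
    term : ∀ u → u ≤ a →
           constP (G N r (N ∸ suc u)) * W ^ (N ∸ suc u) ≈ W ^ r * ((a C u) × (1# ^ u * (Φ * W) ^ (a ∸ u)))
    term u u≤a = begin
      constP (G N r (N ∸ suc u)) * W ^ (N ∸ suc u)
        ≡⟨ ≡.cong₂ (λ z e → constP z * W ^ e) (G-reflected N≡1+r+a u (ℕ.≤-<-trans u≤a a<N)) (N∸1+s≡r+[a∸s] u≤a) ⟩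
      constP (fromℕφ (a C u) *φ φ ^φ e) * W ^ (r ℕ.+ e)        ≈⟨ constP-C-* a u (φ ^φ e) (W ^ (r ℕ.+ e)) ⟩
      (a C u) × (W ^ (r ℕ.+ e) * constP (φ ^φ e))              ≈⟨ ×-congʳ (a C u) regroup ⟩
      (a C u) × (W ^ r * (1# ^ u * (Φ * W) ^ e))               ≈⟨ ×-comm-* (a C u) (W ^ r) _ ⟨
      W ^ r * ((a C u) × (1# ^ u * (Φ * W) ^ e))               ∎
      where
      e = a ∸ u
      regroup : W ^ (r ℕ.+ e) * constP (φ ^φ e) ≈ W ^ r * (1# ^ u * (Φ * W) ^ e)
      regroup = begin
        W ^ (r ℕ.+ e) * constP (φ ^φ e)     ≈⟨ *-cong (^-homo-* W r e) (constP-^ φ e) ⟩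
        (W ^ r * W ^ e) * Φ ^ e             ≈⟨ *-assoc (W ^ r) (W ^ e) (Φ ^ e) ⟩
        W ^ r * (W ^ e * Φ ^ e)
          ≈⟨ *-congˡ {x = W ^ r} (trans (*-comm (W ^ e) (Φ ^ e)) (sym (^-distrib-* Φ W e))) ⟩
        W ^ r * (Φ * W) ^ e
          ≈⟨ *-congˡ {x = W ^ r} (trans (*-congʳ {x = (Φ * W) ^ e} (1#^n≈1# u)) (*-identityˡ _)) ⟨
        W ^ r * (1# ^ u * (Φ * W) ^ e)      ∎

  rowPoly-TG : ∀ {N r a} → N ≡ suc (r ℕ.+ a) →
               rowPoly N (ZφRing.mul N (T N) (G N) r) ≈ (Φ ^ a * (X + Φ) ^ a) * (Φ̄ + (X + Φ)) ^ r
  rowPoly-TG {N} {r} {a} N≡1+r+a = begin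
    rowPoly N (ZφRing.mul N (T N) (G N) r)                    ≈⟨ rowPoly-linear N N (T N r) (G N) ⟩
    ∑[ s < N ] (constP (T N r s) * rowPoly N (G N s))
      ≈⟨ ∑-cong N (λ s s<N → *-congˡ {x = constP (T N r s)} (rowPoly-G (row-split s<N))) ⟩
    ∑[ s < N ] (constP (T N r s) * V ^ (N ∸ suc s))
      ≈⟨ ∑-binomial (Φ ^ a * V ^ a) Φ̄ V (λ s → constP (T N r s) * V ^ (N ∸ suc s)) r<N vanish term ⟩
    (Φ ^ a * V ^ a) * (Φ̄ + V) ^ r                            ∎
    where
    open RowArithmetic {N} {r} {a} N≡1+r+a
    V = X + Φ
    vanish : ∀ s → r < s → s < N → constP (T N r s) * V ^ (N ∸ suc s) ≈ 0#
    vanish s r<s _ = constP-C-*≈0 _ (V ^ (N ∸ suc s)) r<s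
    term : ∀ s → s ≤ r →
           constP (T N r s) * V ^ (N ∸ suc s) ≈ (Φ ^ a * V ^ a) * ((r C s) × (Φ̄ ^ s * V ^ (r ∸ s)))
    term s s≤r = begin
      constP (T N r s) * V ^ (N ∸ suc s)
        ≡⟨ ≡.cong₂ (λ n e → constP (fromℕφ (r C s) *φ (φ ^φ n *φ φ̄ ^φ s)) * V ^ e) N∸1+r≡a (N∸1+s≡a+[r∸s] s≤r) ⟩
      constP (fromℕφ (r C s) *φ (φ ^φ a *φ φ̄ ^φ s)) * V ^ (a ℕ.+ e)  ≈⟨ constP-C-* r s (φ ^φ a *φ φ̄ ^φ s) (V ^ (a ℕ.+ e)) ⟩
      (r C s) × (V ^ (a ℕ.+ e) * constP (φ ^φ a *φ φ̄ ^φ s))          ≈⟨ ×-congʳ (r C s) regroup ⟩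
      (r C s) × ((Φ ^ a * V ^ a) * (Φ̄ ^ s * V ^ e))                   ≈⟨ ×-comm-* (r C s) (Φ ^ a * V ^ a) _ ⟨
      (Φ ^ a * V ^ a) * ((r C s) × (Φ̄ ^ s * V ^ e))                   ∎
      where
      e = r ∸ s
      regroup : V ^ (a ℕ.+ e) * constP (φ ^φ a *φ φ̄ ^φ s) ≈ (Φ ^ a * V ^ a) * (Φ̄ ^ s * V ^ e)
      regroup = begin
        V ^ (a ℕ.+ e) * constP (φ ^φ a *φ φ̄ ^φ s)
          ≈⟨ *-cong (^-homo-* V a e) (trans (constP-* (φ ^φ a) (φ̄ ^φ s)) (*-cong (constP-^ φ a) (constP-^ φ̄ s))) ⟩
        (V ^ a * V ^ e) * (Φ ^ a * Φ̄ ^ s)           ≈⟨ interchange (V ^ a) (V ^ e) (Φ ^ a) (Φ̄ ^ s) ⟩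
        (V ^ a * Φ ^ a) * (V ^ e * Φ̄ ^ s)           ≈⟨ *-cong (*-comm (V ^ a) (Φ ^ a)) (*-comm (V ^ e) (Φ̄ ^ s)) ⟩
        (Φ ^ a * V ^ a) * (Φ̄ ^ s * V ^ e)           ∎

  GA≡TG : ∀ N r c → r < N → c < N → ZφRing.mul N (G N) (A N) r c ≡ ZφRing.mul N (T N) (G N) r c
  GA≡TG N r c r<N c<N = rowPoly-injective N {ZφRing.mul N (G N) (A N) r} {ZφRing.mul N (T N) (G N) r} rows c c<N
    where
    a = N ∸ suc r
    W = X + 1#
    V = X + Φ
    1+Φ*W≈Φ*V : 1# + Φ * W ≈ Φ * V
    1+Φ*W≈Φ*V = begin
      1# + Φ * (X + 1#)      ≈⟨ +-congˡ {x = 1#} (trans (distribˡ Φ X 1#) (+-congˡ {x = Φ * X} (*-identityʳ Φ))) ⟩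
      1# + (Φ * X + Φ)       ≈⟨ x∙yz≈y∙xz 1# (Φ * X) Φ ⟩
      Φ * X + (1# + Φ)       ≈⟨ +-congˡ {x = Φ * X} (trans (+-comm 1# Φ) (sym Φ*Φ≈Φ+1)) ⟩
      Φ * X + Φ * Φ          ≈⟨ distribˡ Φ X Φ ⟨
      Φ * (X + Φ)            ∎
    Φ̄+V≈W : Φ̄ + V ≈ W
    Φ̄+V≈W = x∙yz≈y∙xz Φ̄ X Φ
    rows : rowPoly N (ZφRing.mul N (G N) (A N) r) ≈ rowPoly N (ZφRing.mul N (T N) (G N) r)
    rows = begin
      rowPoly N (ZφRing.mul N (G N) (A N) r)    ≈⟨ rowPoly-GA (row-split r<N) ⟩
      W ^ r * (1# + Φ * W) ^ a                  ≈⟨ *-congˡ {x = W ^ r} (^-congˡ a 1+Φ*W≈Φ*V) ⟩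
      W ^ r * (Φ * V) ^ a                       ≈⟨ *-congˡ {x = W ^ r} (^-distrib-* Φ V a) ⟩
      W ^ r * (Φ ^ a * V ^ a)                   ≈⟨ *-comm (W ^ r) (Φ ^ a * V ^ a) ⟩
      (Φ ^ a * V ^ a) * W ^ r                   ≈⟨ *-congˡ {x = Φ ^ a * V ^ a} (^-congˡ r Φ̄+V≈W) ⟨
      (Φ ^ a * V ^ a) * (Φ̄ + V) ^ r             ≈⟨ rowPoly-TG (row-split r<N) ⟨
      rowPoly N (ZφRing.mul N (T N) (G N) r)    ∎

  module PolyDet = Determinant Poly-commutativeRing
  open PolyDet using (_≈[_]_)

  constMatrix : (ℕ → ℕ → Zφ) → PolyDet.Matrix
  constMatrix M r c = constP (M r c)

  constP-mul : ∀ n M M′ r c → constP (ZφRing.mul n M M′ r c) ≈ PolyDet.mul n (constMatrix M) (constMatrix M′) r c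
  constP-mul n M M′ r c =
    trans (constP-∑ n (λ i → M r i *φ M′ i c)) (∑-cong n (λ i _ → constP-* (M r i) (M′ i c)))

  G-upperTriangular : ∀ N → PolyDet.UpperTriangular N (constMatrix (G N))
  G-upperTriangular N r c c<r r<N = constP-C≈0 (φ ^φ (c ∸ r)) (ℕ.∸-monoʳ-< (s≤s c<r) r<N)

  G-unitDiagonal : ∀ N → PolyDet.UnitDiagonal N (constMatrix (G N))
  G-unitDiagonal N i _ =
    reflexive (≡.cong₂ (λ k e → constP (fromℕφ k *φ φ ^φ e)) (nCn≡1 (N ∸ suc i)) (ℕ.n∸n≡0 i))

  T-lowerTriangular : ∀ N → PolyDet.LowerTriangular N (constMatrix (T N))
  T-lowerTriangular N r c r<c _ = constP-C≈0 (φ ^φ (N ∸ suc r) *φ φ̄ ^φ c) r<c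

  det-charMatrix-A : ∀ N → PolyDet.det N (PolyDet.charMatrix X (constMatrix (A N))) ≈
                           ∏[ i < N ] (X + - constP (φ ^φ (N ∸ suc i) *φ φ̄ ^φ i))
  det-charMatrix-A N = begin
    PolyDet.det N (PolyDet.charMatrix X (constMatrix (A N)))
      ≈⟨ PolyDet.det-charMatrix-similar N X {constMatrix (G N)} {constMatrix (A N)} {constMatrix (T N)}
           (G-upperTriangular N) (G-unitDiagonal N) GA≈TG ⟩
    PolyDet.det N (PolyDet.charMatrix X (constMatrix (T N)))
      ≈⟨ PolyDet.det-charMatrix-lowerTriangular N X {constMatrix (T N)} (T-lowerTriangular N) ⟩
    ∏[ i < N ] (X + - constP (T N i i))
      ≈⟨ ∏-cong N (λ i _ → +-congˡ {x = X} (-‿cong (constP-cong (T-diagonal i)))) ⟩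
    ∏[ i < N ] (X + - constP (φ ^φ (N ∸ suc i) *φ φ̄ ^φ i)) ∎
    where
    GA≈TG : PolyDet.mul N (constMatrix (G N)) (constMatrix (A N)) ≈[ N ] PolyDet.mul N (constMatrix (T N)) (constMatrix (G N))
    GA≈TG r c r<N c<N = trans (sym (constP-mul N (G N) (A N) r c))
                              (trans (constP-cong (GA≡TG N r c r<N c<N)) (constP-mul N (T N) (G N) r c))
    T-diagonal : ∀ i → T N i i ≡ φ ^φ (N ∸ suc i) *φ φ̄ ^φ i
    T-diagonal i =
      ≡.trans (≡.cong (λ k → fromℕφ k *φ (φ ^φ (N ∸ suc i) *φ φ̄ ^φ i)) (nCn≡1 i)) (ZφRing.*-identityˡ _)

module FinIndexed where

  open import Defs using (Zφ; sgn; Poly; scaleP; _*P_; constP; X; sumFin; charPoly)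
  import Defs
  open import Data.Fin.Base as Fin using (Fin; zero; suc; toℕ)
  open import Data.Fin.Properties using (toℕ-injective) renaming (_≟_ to _≟ᶠ_)
  open import Data.Empty using (⊥-elim)
  open import Relation.Nullary.Decidable using (yes; no)
  open Polynomial
  open BinomialMatrices using (module PolyDet; constMatrix)
  open PolyDet using (Matrix; sign; punchIn; minor; det; charMatrix)
  open BigOperators Poly-commutativeRing using (∑)

  toℕ-punchIn : ∀ {n} (j : Fin (suc n)) (c : Fin n) → toℕ (Fin.punchIn j c) ≡ punchIn (toℕ j) (toℕ c)
  toℕ-punchIn zero    c       = ≡.refl
  toℕ-punchIn (suc j) zero    = ≡.refl
  toℕ-punchIn (suc j) (suc c) = ≡.cong suc (toℕ-punchIn j c)

  sumFin≋∑ : ∀ n (f : Fin n → Poly) (g : ℕ → Poly) → (∀ j → f j ≋ g (toℕ j)) → sumFin f ≋ ∑ n g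
  sumFin≋∑ zero    f g f≋g = ≋-refl
  sumFin≋∑ (suc n) f g f≋g = +P-cong (f≋g zero) (sumFin≋∑ n (f ∘ suc) (g ∘ suc) (f≋g ∘ suc))
    where open import Function.Base using (_∘_)

  scaleP≋constP-*P : ∀ c p → scaleP c p ≋ constP c *P p
  scaleP≋constP-*P c p = coeffwise λ i → ≡.trans (coeff-scaleP c p i) (≡.sym (coeff-constP-*P c p i))

  constP-sgn : ∀ j → constP (sgn j) ≋ sign j
  constP-sgn zero    = ≋-refl
  constP-sgn (suc j) = -P-cong (constP-sgn j)

  det≋det : ∀ n (M : Fin n → Fin n → Poly) (M′ : Matrix) →
            (∀ i j → M i j ≋ M′ (toℕ i) (toℕ j)) → Defs.det M ≋ det n M′
  det≋det zero    M M′ M≋M′ = ≋-refl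
  det≋det (suc n) M M′ M≋M′ = sumFin≋∑ (suc n) _ (λ j → sign j *P (M′ 0 j *P det n (minor M′ j))) λ j →
    ≋-trans (scaleP≋constP-*P (sgn (toℕ j)) (M zero j *P Defs.det (Defs.minor M j)))
            (*P-cong (constP-sgn (toℕ j)) (*P-cong (M≋M′ zero j) (det≋det n (Defs.minor M j) (minor M′ (toℕ j)) (λ r c →
              ≋-trans (M≋M′ (suc r) (Fin.punchIn j c)) (≋-reflexive (≡.cong (M′ (suc (toℕ r))) (toℕ-punchIn j c)))))))

  mutual
    charPoly≋det : ∀ n (A : ℕ → ℕ → Zφ) →
                   charPoly (λ (i j : Fin n) → A (toℕ i) (toℕ j)) ≋ det n (charMatrix X (constMatrix A))
    charPoly≋det n A = det≋det n _ (charMatrix X (constMatrix A)) (charPoly-entry A)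

    -- The left-hand side is left to unification: it is an entry of the matrix built inside
    -- Defs.charPoly, whose where-bound identity part cannot be named.
    charPoly-entry : ∀ {n} (A : ℕ → ℕ → Zφ) (i j : Fin n) → _ ≋ charMatrix X (constMatrix A) (toℕ i) (toℕ j)
    charPoly-entry A i j with i ≟ᶠ j | toℕ i ℕ.≟ toℕ j
    ... | yes ≡.refl | yes _   = ≋-refl
    ... | yes ≡.refl | no  i≢i = ⊥-elim (i≢i ≡.refl)
    ... | no  i≢j    | yes i≡j = ⊥-elim (i≢j (toℕ-injective i≡j))
    ... | no  _      | no  _   = ≋-refl

module GoldenPowers where

  open import Defs using (Zφ; 1φ; φ; φ̄; -φ_; _*φ_; _^φ_; sgn)
  open ℤ[φ] using (Zφ-commutativeRing)
  open CommutativeRing Zφ-commutativeRing using (*-assoc; *-identityˡ; *-identityʳ; *-commutativeSemigroup)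
  open import Algebra.Properties.CommutativeSemigroup *-commutativeSemigroup using (interchange; xy∙z≈xz∙y)
  open ≡.≡-Reasoning

  ^φ-+ : ∀ x m n → x ^φ (m ℕ.+ n) ≡ x ^φ m *φ x ^φ n
  ^φ-+ x zero    n = ≡.sym (*-identityˡ _)
  ^φ-+ x (suc m) n = ≡.trans (≡.cong (x *φ_) (^φ-+ x m n)) (≡.sym (*-assoc x (x ^φ m) (x ^φ n)))

  φ^n*φ̄^n≡sgn : ∀ n → φ ^φ n *φ φ̄ ^φ n ≡ sgn n
  φ^n*φ̄^n≡sgn zero    = ≡.refl
  φ^n*φ̄^n≡sgn (suc n) = ≡.trans (interchange φ (φ ^φ n) φ̄ (φ̄ ^φ n)) (≡.cong ((-φ 1φ) *φ_) (φ^n*φ̄^n≡sgn n))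

  sgn-+-double : ∀ j m → sgn (j ℕ.+ (m ℕ.+ m)) ≡ sgn j
  sgn-+-double j m =
    ≡.trans (^φ-+ (-φ 1φ) j (m ℕ.+ m)) (≡.trans (≡.cong (sgn j *φ_) (sgn-double m)) (*-identityʳ (sgn j)))
    where
    sgn-double : ∀ m → sgn (m ℕ.+ m) ≡ 1φ
    sgn-double zero    = ≡.refl
    sgn-double (suc m) = ≡.trans (≡.cong (λ n → (-φ 1φ) *φ sgn n) (ℕ.+-suc m m))
      (≡.trans (≡.sym (*-assoc (-φ 1φ) (-φ 1φ) (sgn (m ℕ.+ m))))
      (≡.trans (*-identityˡ (sgn (m ℕ.+ m))) (sgn-double m)))

  eigenvalue : ℕ → ℕ → Zφ
  eigenvalue N b = φ ^φ (N ∸ suc b) *φ φ̄ ^φ b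

  eigenvalue-φ : ∀ j e → eigenvalue (suc (j ℕ.+ e ℕ.+ j)) j ≡ sgn j *φ φ ^φ e
  eigenvalue-φ j e = begin
    φ ^φ (j ℕ.+ e ℕ.+ j ∸ j) *φ φ̄ ^φ j        ≡⟨ ≡.cong (λ n → φ ^φ n *φ φ̄ ^φ j) (ℕ.m+n∸n≡m (j ℕ.+ e) j) ⟩
    φ ^φ (j ℕ.+ e) *φ φ̄ ^φ j                   ≡⟨ ≡.cong (_*φ φ̄ ^φ j) (^φ-+ φ j e) ⟩
    (φ ^φ j *φ φ ^φ e) *φ φ̄ ^φ j               ≡⟨ xy∙z≈xz∙y (φ ^φ j) (φ ^φ e) (φ̄ ^φ j) ⟩
    (φ ^φ j *φ φ̄ ^φ j) *φ φ ^φ e               ≡⟨ ≡.cong (_*φ φ ^φ e) (φ^n*φ̄^n≡sgn j) ⟩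
    sgn j *φ φ ^φ e                            ∎

  eigenvalue-φ̄ : ∀ j e → eigenvalue (suc (j ℕ.+ e ℕ.+ j)) (j ℕ.+ e) ≡ sgn j *φ φ̄ ^φ e
  eigenvalue-φ̄ j e = begin
    φ ^φ (j ℕ.+ e ℕ.+ j ∸ (j ℕ.+ e)) *φ φ̄ ^φ (j ℕ.+ e)
      ≡⟨ ≡.cong (λ n → φ ^φ n *φ φ̄ ^φ (j ℕ.+ e)) (ℕ.m+n∸m≡n (j ℕ.+ e) j) ⟩
    φ ^φ j *φ φ̄ ^φ (j ℕ.+ e)                             ≡⟨ ≡.cong (φ ^φ j *φ_) (^φ-+ φ̄ j e) ⟩
    φ ^φ j *φ (φ̄ ^φ j *φ φ̄ ^φ e)                         ≡⟨ *-assoc (φ ^φ j) (φ̄ ^φ j) (φ̄ ^φ e) ⟨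
    (φ ^φ j *φ φ̄ ^φ j) *φ φ̄ ^φ e                         ≡⟨ ≡.cong (_*φ φ̄ ^φ e) (φ^n*φ̄^n≡sgn j) ⟩
    sgn j *φ φ̄ ^φ e                                      ∎

module Eigenvalues where

  open import Defs using (φ; φ̄; _*φ_; _^φ_; sgn; Poly; constP; X; charPoly; R; pairFactor; prodP)
  open import Data.Nat.Base using () renaming (_+_ to _+ℕ_; _*_ to _*ℕ_)
  open import Data.Nat.Tactic.RingSolver using (solve-∀)
  open GoldenPowers
  open Polynomial using (_≋_; ≋-trans; Poly-commutativeRing)
  open CommutativeRing Poly-commutativeRing using (setoid; _≈_; _+_; _*_; -_; *-cong; *-congˡ; refl)
  open BigOperators Poly-commutativeRing using (∏; ∏₁; ∏₁-cong; ∏-pairs-even; ∏-pairs-odd)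
  open import Relation.Binary.Reasoning.Setoid setoid

  factor : ℕ → ℕ → Poly
  factor N b = X + - constP (eigenvalue N b)

  evenPair oddPair : ℕ → ℕ → Poly
  evenPair k i = pairFactor (sgn (k +ℕ i) *φ φ ^φ (2 *ℕ i ∸ 1)) (sgn (k +ℕ i) *φ φ̄ ^φ (2 *ℕ i ∸ 1))
  oddPair  k i = pairFactor (sgn (k +ℕ i) *φ φ ^φ (2 *ℕ i)) (sgn (k +ℕ i) *φ φ̄ ^φ (2 *ℕ i))

  charPoly-R≋∏ : ∀ N → charPoly (R N) ≋ ∏[ b < N ] factor N b
  charPoly-R≋∏ N = ≋-trans (FinIndexed.charPoly≋det N (BinomialMatrices.A N)) (BinomialMatrices.det-charMatrix-A N)

  ∏₁≋prodP : ∀ k f → ∏₁ k f ≋ prodP k f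
  ∏₁≋prodP zero    f = refl
  ∏₁≋prodP (suc k) f = *-cong (∏₁≋prodP k f) refl

  factor-≡ : ∀ N b {x} → eigenvalue N b ≡ x → factor N b ≈ X + - constP x
  factor-≡ N b ≡.refl = refl

  2k≡k+k : ∀ k → 2 *ℕ k ≡ k +ℕ k
  2k≡k+k k = ≡.cong (k +ℕ_) (ℕ.+-identityʳ k)

  even-pair : ∀ {k} j i → k ≡ j +ℕ suc i →
              factor (2 *ℕ k) (k ∸ suc i) * factor (2 *ℕ k) (k +ℕ suc i ∸ 1) ≈ evenPair k (suc i)
  even-pair j i ≡.refl = *-cong (factor-≡ (2 *ℕ k) (k ∸ suc i) root) (factor-≡ (2 *ℕ k) (k +ℕ suc i ∸ 1) root̄)
    where
    k = j +ℕ suc i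
    e = 2 *ℕ suc i ∸ 1
    e≡1+2i : e ≡ suc (2 *ℕ i)
    e≡1+2i = ℕ.+-suc i (i +ℕ 0)
    shape : 2 *ℕ k ≡ suc (j +ℕ e +ℕ j)
    shape = ≡.trans (ring j i) (≡.cong (λ e → suc (j +ℕ e +ℕ j)) (≡.sym e≡1+2i))
      where
      ring : ∀ j i → 2 *ℕ (j +ℕ suc i) ≡ suc (j +ℕ suc (2 *ℕ i) +ℕ j)
      ring = solve-∀
    index : k +ℕ suc i ∸ 1 ≡ j +ℕ e
    index = ≡.trans (≡.cong (_∸ 1) (ring j i)) (≡.cong (j +ℕ_) (≡.sym e≡1+2i))
      where
      ring : ∀ j i → j +ℕ suc i +ℕ suc i ≡ suc (j +ℕ suc (2 *ℕ i))
      ring = solve-∀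
    sign : sgn j ≡ sgn (k +ℕ suc i)
    sign = ≡.sym (≡.trans (≡.cong sgn (ℕ.+-assoc j (suc i) (suc i))) (sgn-+-double j (suc i)))
    root : eigenvalue (2 *ℕ k) (k ∸ suc i) ≡ sgn (k +ℕ suc i) *φ φ ^φ e
    root = ≡.trans (≡.cong₂ eigenvalue shape (ℕ.m+n∸n≡m j (suc i)))
                   (≡.trans (eigenvalue-φ j e) (≡.cong (_*φ φ ^φ e) sign))
    root̄ : eigenvalue (2 *ℕ k) (k +ℕ suc i ∸ 1) ≡ sgn (k +ℕ suc i) *φ φ̄ ^φ e
    root̄ = ≡.trans (≡.cong₂ eigenvalue shape index) (≡.trans (eigenvalue-φ̄ j e) (≡.cong (_*φ φ̄ ^φ e) sign))

  odd-pair : ∀ {k} j i → k ≡ j +ℕ i →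
             factor (suc (2 *ℕ k)) (k ∸ i) * factor (suc (2 *ℕ k)) (k +ℕ i) ≈ oddPair k i
  odd-pair j i ≡.refl = *-cong (factor-≡ (suc (2 *ℕ k)) (k ∸ i) root) (factor-≡ (suc (2 *ℕ k)) (k +ℕ i) root̄)
    where
    k = j +ℕ i
    shape : suc (2 *ℕ k) ≡ suc (j +ℕ 2 *ℕ i +ℕ j)
    shape = ring j i
      where
      ring : ∀ j i → suc (2 *ℕ (j +ℕ i)) ≡ suc (j +ℕ 2 *ℕ i +ℕ j)
      ring = solve-∀
    index : k +ℕ i ≡ j +ℕ 2 *ℕ i
    index = ring j i
      where
      ring : ∀ j i → j +ℕ i +ℕ i ≡ j +ℕ 2 *ℕ i
      ring = solve-∀
    sign : sgn j ≡ sgn (k +ℕ i)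
    sign = ≡.sym (≡.trans (≡.cong sgn (ℕ.+-assoc j i i)) (sgn-+-double j i))
    root : eigenvalue (suc (2 *ℕ k)) (k ∸ i) ≡ sgn (k +ℕ i) *φ φ ^φ (2 *ℕ i)
    root = ≡.trans (≡.cong₂ eigenvalue shape (ℕ.m+n∸n≡m j i))
                   (≡.trans (eigenvalue-φ j (2 *ℕ i)) (≡.cong (_*φ φ ^φ (2 *ℕ i)) sign))
    root̄ : eigenvalue (suc (2 *ℕ k)) (k +ℕ i) ≡ sgn (k +ℕ i) *φ φ̄ ^φ (2 *ℕ i)
    root̄ = ≡.trans (≡.cong₂ eigenvalue shape index)
                   (≡.trans (eigenvalue-φ̄ j (2 *ℕ i)) (≡.cong (_*φ φ̄ ^φ (2 *ℕ i)) sign))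

  middle : ∀ k → factor (suc (2 *ℕ k)) k ≈ X + - constP (sgn k)
  middle k = factor-≡ (suc (2 *ℕ k)) k (≡.trans (≡.cong (λ n → eigenvalue (suc n) k) (ring k))
                                                 (≡.trans (eigenvalue-φ k 0) (*-identityʳ (sgn k))))
    where
    open CommutativeRing ℤ[φ].Zφ-commutativeRing using (*-identityʳ)
    ring : ∀ k → 2 *ℕ k ≡ k +ℕ 0 +ℕ k
    ring = solve-∀

  charPoly-even : ∀ k → charPoly (R (2 *ℕ k)) ≋ prodP k (evenPair k)
  charPoly-even k = begin
    charPoly (R (2 *ℕ k))                     ≈⟨ charPoly-R≋∏ (2 *ℕ k) ⟩
    ∏[ b < 2 *ℕ k ] factor (2 *ℕ k) b         ≡⟨ ≡.cong (λ n → ∏ n (factor (2 *ℕ k))) (2k≡k+k k) ⟩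
    ∏[ b < k +ℕ k ] factor (2 *ℕ k) b         ≈⟨ ∏-pairs-even k (factor (2 *ℕ k)) ⟩
    ∏₁ k (λ i → factor (2 *ℕ k) (k ∸ i) * factor (2 *ℕ k) (k +ℕ i ∸ 1))
      ≈⟨ ∏₁-cong k (λ { (suc i) _ i<k → even-pair (k ∸ suc i) i (≡.sym (ℕ.m∸n+n≡m i<k)) }) ⟩
    ∏₁ k (evenPair k)                         ≈⟨ ∏₁≋prodP k (evenPair k) ⟩
    prodP k (evenPair k)                      ∎

  charPoly-odd : ∀ k → charPoly (R (suc (2 *ℕ k))) ≋ (X + - constP (sgn k)) * prodP k (oddPair k)
  charPoly-odd k = begin
    charPoly (R (suc (2 *ℕ k)))                          ≈⟨ charPoly-R≋∏ (suc (2 *ℕ k)) ⟩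
    ∏[ b < suc (2 *ℕ k) ] factor (suc (2 *ℕ k)) b        ≡⟨ ≡.cong (λ n → ∏ (suc n) (factor (suc (2 *ℕ k)))) (2k≡k+k k) ⟩
    ∏[ b < suc (k +ℕ k) ] factor (suc (2 *ℕ k)) b        ≈⟨ ∏-pairs-odd k (factor (suc (2 *ℕ k))) ⟩
    factor (suc (2 *ℕ k)) k * ∏₁ k (λ i → factor (suc (2 *ℕ k)) (k ∸ i) * factor (suc (2 *ℕ k)) (k +ℕ i))
      ≈⟨ *-cong (middle k) (∏₁-cong k (λ i _ i≤k → odd-pair (k ∸ i) i (≡.sym (ℕ.m∸n+n≡m i≤k)))) ⟩
    (X + - constP (sgn k)) * ∏₁ k (oddPair k)
      ≈⟨ *-congˡ {x = X + - constP (sgn k)} (∏₁≋prodP k (oddPair k)) ⟩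
    (X + - constP (sgn k)) * prodP k (oddPair k)         ∎

open import Defs
open import Data.Nat using (ℕ; suc; _+_; _*_; _∸_)
open import Data.Product using (_×_; _,_)
open Polynomial using (same-coeff)

mainTheorem4 : (k : ℕ)
    → (charPoly (R (2 * k)) ≈P
         prodP k (λ i → pairFactor (sgn (k + i) *φ (φ ^φ (2 * i ∸ 1)))
                                   (sgn (k + i) *φ (φ̄ ^φ (2 * i ∸ 1)))))
    × (charPoly (R (suc (2 * k))) ≈P
         ((X -P constP (sgn k)) *P
           prodP k (λ i → pairFactor (sgn (k + i) *φ (φ ^φ (2 * i)))
                                     (sgn (k + i) *φ (φ̄ ^φ (2 * i))))))
mainTheorem4 k = same-coeff (Eigenvalues.charPoly-even k) , same-coeff (Eigenvalues.charPoly-odd k)
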